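{- Let $P$ be a self-dual poset and let $x \in P$. Let $f \in \mathrm{Inc}^q(P)$ be such that $\gcd(r\ell/q,\tau) = 1$, where $\ell$ is the period of $\mathrm{Con}(f)$, $\overline{f}$ is $r$-packed, and $\tau$ is the size of the promotion orbit of $\overline{f}$ in $\mathrm{Inc}^r(P)$. Let $\mathcal{O}$ be the promotion orbit of elements of $\mathrm{Inc}^q(P)$ containing $f$. If the deflated orbit $\overline{\mathcal{O}}$ is $x$-stable, then $\mathcal{O}$ exhibits orbitmesy with respect to the antipodal sum statistic $\mathcal{A}_x$.
   Context: $P$ is a finite self-dual poset with fixed order-reversing involution $\kappa$. $\mathrm{Inc}^q(P)$ is the set of increasing labelings $f:P\to[q]$ ($f(x)<f(y)$ whenever $x<y$). Promotion: replace labels $1$ by empty boxes; for $i=2,\dots,q$ slide boxes upward (a box at $x$ becomes $i$ if some $y\gtrdot x$ is labeled $i$, and that element becomes a box); replace boxes by $q+1$ and subtract $1$ from all labels. $\mathrm{Con}(f)=(c_1,\dots,c_q)$ with $c_i=1$ iff label $i$ is used; period = least number of cyclic shifts fixing it. The deflation $\overline{f}$ replaces the $j$-th smallest used label by $j$ ($r$-packed: exactly $r$ labels used); the deflated orbit $\overline{\mathcal{O}}$ is the promotion orbit of $\overline{f}$ in $\mathrm{Inc}^r(P)$, which consists of the deflations of all elements of $\mathcal{O}$. A promotion orbit $\mathcal{O}'$ of $\mathrm{Inc}^m(P)$ is $x$-stable if for all $1\le k\le m$ the multiplicity of $k$ in the multiset $\{g(x),g(\kappa(x))\}_{g\in\mathcal{O}'}$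 equals the multiplicity of $m+1-k$. $\mathcal{A}_x(f)=f(x)+f(\kappa(x))$. Orbitmesy: orbit average equals the average over all of $\mathrm{Inc}^q(P)$. -}

module Defs where

open import Data.Nat using (ℕ; zero; suc; _+_; _*_; _∸_; _≤_; _<_; _≡ᵇ_; NonZero)
open import Data.Nat.Properties using (_≟_)
open import Data.Nat.DivMod using (_%_)
open import Data.Fin using (Fin)
import Data.Fin.Properties as FinP
open import Data.Bool using (Bool; true; false; if_then_else_; _∧_)
open import Data.Nat.ListAction using (sum)
open import Data.List using (List; []; _∷_; map; concatMap; length; filterᵇ; applyUpTo)
open import Data.Product using (_×_; _,_; ∃; Σ)
open import Relation.Binary using (IsDecPartialOrder)
open import Relation.Nullary using (¬_; Dec; yes; no; does)
open import Relation.Nullary.Decidable using (_×-dec_; ¬?; ⌊_⌋)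
open import Relation.Binary.PropositionalEquality using (_≡_; _≢_)

record FinPoset : Set₁ where
  field
    size  : ℕ
    _≼_   : Fin size → Fin size → Set
    isDecPartialOrder : IsDecPartialOrder _≡_ _≼_

  open IsDecPartialOrder isDecPartialOrder public
    using () renaming (_≟_ to _≟ₚ_; _≤?_ to _≼?_)

  _≺_ : Fin size → Fin size → Set
  x ≺ y = x ≼ y × x ≢ y

  _≺?_ : ∀ x y → Dec (x ≺ y)
  x ≺? y = (x ≼? y) ×-dec ¬? (x ≟ₚ y)

  _⋖_ : Fin size → Fin size → Set
  x ⋖ y = x ≺ y × ¬ (∃ λ z → x ≺ z × z ≺ y)

  _⋖?_ : ∀ x y → Dec (x ⋖ y)
  x ⋖? y = (x ≺? y) ×-dec ¬? (FinP.any? (λ z → (x ≺? z) ×-dec (z ≺? y)))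

record SelfDual (P : FinPoset) : Set where
  open FinPoset P
  field
    κ          : Fin size → Fin size
    involutive : ∀ x → κ (κ x) ≡ x
    reversing  : ∀ x y → x ≼ y → κ y ≼ κ x

module _ (P : FinPoset) where
  open FinPoset P

  Labeling : Set
  Labeling = Fin size → ℕ

  IsInc : ℕ → Labeling → Set
  IsInc q f = (∀ x → 1 ≤ f x × f x ≤ q) × (∀ x y → x ≺ y → f x < f y)

  isInc? : ∀ q f → Dec (IsInc q f)
  isInc? q f =
    FinP.all? (λ x → (1 Data.Nat.≤? f x) ×-dec (f x Data.Nat.≤? q))
    ×-dec FinP.all? (λ x → FinP.all? (λ y → decImp (x ≺? y) (f x Data.Nat.<? f y)))
    where
      decImp : ∀ {A B : Set} → Dec A → Dec B → Dec (A → B)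
      decImp (yes a) (yes b) = yes (λ _ → b)
      decImp (yes a) (no ¬b) = no (λ h → ¬b (h a))
      decImp (no ¬a) _       = yes (λ a → Data.Empty.⊥-elim (¬a a))
        where import Data.Empty

  -- Promotion.  During promotion a box is represented by the label 0.

  coverAboveHas : Labeling → ℕ → Fin size → Bool
  coverAboveHas g i x = ⌊ FinP.any? (λ y → (x ⋖? y) ×-dec (g y ≟ i)) ⌋

  coverBelowHas : Labeling → ℕ → Fin size → Bool
  coverBelowHas g i x = ⌊ FinP.any? (λ z → (z ⋖? x) ×-dec (g z ≟ i)) ⌋

  slideStep : ℕ → Labeling → Labeling
  slideStep i g x =
    if (g x ≡ᵇ 0) ∧ coverAboveHas g i x then i
    else if (g x ≡ᵇ i) ∧ coverBelowHas g 0 x then 0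
    else g x

  slidesUpTo : ℕ → Labeling → Labeling
  slidesUpTo zero          g = g
  slidesUpTo (suc zero)    g = g
  slidesUpTo (suc (suc m)) g = slideStep (suc (suc m)) (slidesUpTo (suc m) g)

  pro : ℕ → Labeling → Labeling
  pro q f = finish (slidesUpTo q start)
    where
      start : Labeling
      start x = if f x ≡ᵇ 1 then 0 else f x
      -- boxes become q+1, then subtract 1 from all labels
      finish : Labeling → Labeling
      finish g x = if g x ≡ᵇ 0 then q else g x ∸ 1

  proIter : ℕ → ℕ → Labeling → Labeling
  proIter q zero    f = f
  proIter q (suc k) f = pro q (proIter q k f)

  _≗ₗ_ : Labeling → Labeling → Set
  f ≗ₗ g = ∀ x → f x ≡ g x

  IsOrbitSize : ℕ → Labeling → ℕ → Set
  IsOrbitSize q f τ =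
    1 ≤ τ × proIter q τ f ≗ₗ f × (∀ k → 1 ≤ k → k < τ → ¬ (proIter q k f ≗ₗ f))

  used : Labeling → ℕ → Bool
  used f i = ⌊ FinP.any? (λ x → f x ≟ i) ⌋

  -- Con(f) = (c_1,…,c_q), indexed from 0: con f j = c_{j+1}
  con : Labeling → ℕ → Bool
  con f j = used f (suc j)

  IsConPeriod : (q : ℕ) .{{_ : NonZero q}} → Labeling → ℕ → Set
  IsConPeriod q f ℓ =
    1 ≤ ℓ
    × (∀ j → j < q → con f ((j + ℓ) % q) ≡ con f j)
    × (∀ m → 1 ≤ m → m < ℓ → ¬ (∀ j → j < q → con f ((j + m) % q) ≡ con f j))

  indicator : Bool → ℕ
  indicator true  = 1
  indicator false = 0

  usedUpTo : Labeling → ℕ → ℕ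
  usedUpTo f zero    = 0
  usedUpTo f (suc v) = usedUpTo f v + indicator (used f (suc v))

  -- number of labels used by f ∈ Inc^q(P)  (f̄ is r-packed with r = this)
  numUsed : ℕ → Labeling → ℕ
  numUsed q f = usedUpTo f q

  -- deflation: j-th smallest used label ↦ j
  deflate : Labeling → Labeling
  deflate f x = usedUpTo f (f x)

  countEq : ℕ → ℕ → ℕ
  countEq a k = indicator (a ≡ᵇ k)

  orbitSum : ℕ → Labeling → ℕ → (Labeling → ℕ) → ℕ
  orbitSum q f τ h = sum (applyUpTo (λ k → h (proIter q k f)) τ)

  -- multiplicity of k in the multiset {g(x), g(κ x)}_{g ∈ orbit of f in Inc^m}
  antipodalMult : (κ : Fin size → Fin size) → Fin size → ℕ → Labeling → ℕ → ℕ → ℕ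
  antipodalMult κ x m f τ k = orbitSum m f τ (λ g → countEq (g x) k + countEq (g (κ x)) k)

  IsXStable : (κ : Fin size → Fin size) → Fin size → ℕ → Labeling → ℕ → Set
  IsXStable κ x m f τ =
    ∀ k → 1 ≤ k → k ≤ m → antipodalMult κ x m f τ k ≡ antipodalMult κ x m f τ (suc m ∸ k)

  antipodalSum : (κ : Fin size → Fin size) → Fin size → Labeling → ℕ
  antipodalSum κ x g = g x + g (κ x)

allLabelingsFin : (n q : ℕ) → List (Fin n → ℕ)
allLabelingsFin zero    q = (λ ()) ∷ []
allLabelingsFin (suc n) q =
  concatMap (λ v → map (λ g → cons v g) (allLabelingsFin n q)) (applyUpTo suc q)
  where
    cons : ℕ → (Fin n → ℕ) → Fin (suc n) → ℕ
    cons v g Fin.zero    = v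
    cons v g (Fin.suc i) = g i

module _ (P : FinPoset) where
  open FinPoset P

  incList : ℕ → List (Labeling P)
  incList q = filterᵇ (λ f → ⌊ isInc? P q f ⌋) (allLabelingsFin size q)

  -- Orbitmesy: the average of h over the orbit of f (size σ) equals the
  -- average of h over Inc^q(P); stated by cross-multiplication.
  Orbitmesy : ℕ → Labeling P → ℕ → (Labeling P → ℕ) → Set
  Orbitmesy q f σ h =
    orbitSum P q f σ h * length (incList q) ≡ sum (map h (incList q)) * σ

{-# OPTIONS --safe #-}
-- Write r for the number of labels used by f, ℓ for the period of its content and τ for the
-- size of the promotion orbit of its deflation.  Promotion rotates the content of f by one
-- place and promotes the deflation exactly when label 1 is used; since a labelling is
-- determined by its content and its deflation, (pro^k f)(x) counts the t < q for which the
-- number of used labels among the first t labels of the rotated content (a window) is below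
-- the deflated value at x.  Over τℓ promotions the windows repeat with period ℓ, while the
-- deflation advances by rℓ/q per period, which is prime to τ, so each window meets every
-- element of the deflated orbit equally often.  x-stability makes the numbers of antipodal
-- values above c and above r − c add up to 2τ, and the window of length t starting at a is
-- complementary to the window of length q − t starting at a + t; hence A_x averages to q + 1
-- on the orbit.  On all of Inc^q(P) the involution f ↦ q + 1 − f ∘ κ sends A_x to
-- 2(q + 1) − A_x, so the global average is q + 1 as well.
module Submission where

open import Defs
open import Data.Nat using (ℕ; _*_; NonZero)
open import Data.Nat.DivMod using (_/_)
open import Data.Nat.GCD using (gcd)
open import Data.Fin using (Fin)
open import Relation.Binary.PropositionalEquality using (_≡_)

open import Data.Nat using (zero; suc; _+_; _∸_; _≤_; _<_; z≤n; s≤s; _≡ᵇ_; >-nonZero; >-nonZero⁻¹)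
open import Data.Nat.Properties
open import Data.Nat.DivMod using (_%_; m≡m%n+[m/n]*n; m%n<n; m<n⇒m%n≡m; [m+n]%n≡m%n; %-distribˡ-+; m%n%n≡m%n; m*n/n≡m)
open import Data.Nat.Divisibility using (_∣_; divides; n∣m⇒m%n≡0)
open import Data.Nat.Coprimality using (Coprime; coprime-divisor; gcd≡1⇒coprime)
import Data.Nat.Coprimality as Coprimality
open import Data.Nat.ListAction using (sum)
open import Data.Nat.Solver using (module +-*-Solver)
open import Data.Bool using (Bool; true; false; T; if_then_else_)
open import Algebra.Properties.CommutativeSemigroup +-commutativeSemigroup using (interchange; xy∙z≈xz∙y)
open import Data.Fin using (zero; suc)
import Data.Fin.Properties as FinP
open import Data.List using (List; []; _∷_; _++_; map; concatMap; length; filterᵇ; applyUpTo)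
open import Data.Empty using (⊥-elim)
open import Data.List.Properties using (map-cong; map-cong-local)
open import Data.List.Relation.Unary.All using (All)
import Data.List.Relation.Unary.All as All
open import Data.List.Relation.Unary.All.Properties using (all-filter)
open import Data.Product using (_×_; _,_; ∃; proj₁; proj₂)
open import Data.Sum using (_⊎_; inj₁; inj₂; [_,_]′)
open import Function.Base using (_∘_)
open import Function.Bundles using (mk⇔)
open import Relation.Binary.Core using (_Preserves_⟶_)
open import Relation.Binary.Definitions using (tri<; tri≈; tri>)
open import Relation.Binary.PropositionalEquality using (_≢_; _≗_; refl; sym; trans; cong; cong₂; subst; subst₂; module ≡-Reasoning)
open import Relation.Nullary using (¬_; Dec; yes; no; does)
open import Relation.Nullary.Decidable using (⌊_⌋; _×-dec_; map′; isYes≗does; dec-true; dec-false; does-⇔; T?; toWitness; fromWitness)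

private variable
  A B : Set

-- Finite sums over initial segments of ℕ

∑< : ℕ → (ℕ → ℕ) → ℕ
∑< zero    F = 0
∑< (suc n) F = ∑< n F + F n

syntax ∑< n (λ k → e) = ∑[ k < n ] e

∑-cong-< : ∀ n {F G : ℕ → ℕ} → (∀ k → k < n → F k ≡ G k) → ∑< n F ≡ ∑< n G
∑-cong-< zero    eq = refl
∑-cong-< (suc n) eq = cong₂ _+_ (∑-cong-< n (λ k k<n → eq k (m<n⇒m<1+n k<n))) (eq n ≤-refl)

∑-cong : ∀ n {F G : ℕ → ℕ} → (∀ k → F k ≡ G k) → ∑< n F ≡ ∑< n G
∑-cong n eq = ∑-cong-< n (λ k _ → eq k)

∑-+ : ∀ n (F G : ℕ → ℕ) → ∑[ k < n ] (F k + G k) ≡ ∑< n F + ∑< n G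
∑-+ zero    F G = refl
∑-+ (suc n) F G rewrite ∑-+ n F G = interchange (∑< n F) (∑< n G) (F n) (G n)

∑-*ˡ : ∀ n c (F : ℕ → ℕ) → ∑[ k < n ] (c * F k) ≡ c * ∑< n F
∑-*ˡ zero    c F = sym (*-zeroʳ c)
∑-*ˡ (suc n) c F rewrite ∑-*ˡ n c F = sym (*-distribˡ-+ c (∑< n F) (F n))

∑-*ʳ : ∀ n c (F : ℕ → ℕ) → ∑[ k < n ] (F k * c) ≡ ∑< n F * c
∑-*ʳ n c F = trans (∑-cong n (λ k → *-comm (F k) c)) (trans (∑-*ˡ n c F) (*-comm c (∑< n F)))

∑-const : ∀ n c → ∑[ _ < n ] c ≡ n * c
∑-const zero    c = refl
∑-const (suc n) c rewrite ∑-const n c = +-comm (n * c) c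

∑-zero : ∀ n → ∑[ _ < n ] 0 ≡ 0
∑-zero n = trans (∑-const n 0) (*-zeroʳ n)

∑-split : ∀ m n (F : ℕ → ℕ) → ∑< (m + n) F ≡ ∑< m F + ∑[ k < n ] F (m + k)
∑-split m zero    F rewrite +-identityʳ m = sym (+-identityʳ (∑< m F))
∑-split m (suc n) F rewrite +-suc m n | ∑-split m n F = +-assoc (∑< m F) _ (F (m + n))

∑-head : ∀ n (F : ℕ → ℕ) → ∑< (suc n) F ≡ F 0 + ∑[ k < n ] F (suc k)
∑-head n F = ∑-split 1 n F

∑-swap : ∀ m n (F : ℕ → ℕ → ℕ) → ∑[ a < m ] ∑[ b < n ] F a b ≡ ∑[ b < n ] ∑[ a < m ] F a b
∑-swap zero    n F = sym (∑-zero n)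
∑-swap (suc m) n F rewrite ∑-swap m n F = sym (∑-+ n (λ b → ∑[ a < m ] F a b) (F m))

∑-reverse : ∀ n (F : ℕ → ℕ) → ∑< n F ≡ ∑[ k < n ] F (n ∸ suc k)
∑-reverse zero    F = refl
∑-reverse (suc n) F = begin
  ∑< n F + F n                           ≡⟨ cong (_+ F n) (∑-reverse n F) ⟩
  ∑[ k < n ] F (n ∸ suc k) + F n         ≡⟨ +-comm _ (F n) ⟩
  F n + ∑[ k < n ] F (n ∸ suc k)         ≡⟨ ∑-head n (λ k → F (suc n ∸ suc k)) ⟨
  ∑[ k < suc n ] F (suc n ∸ suc k)       ∎
  where open ≡-Reasoning

∑-blocks : ∀ m p (F : ℕ → ℕ) → ∑< (m * p) F ≡ ∑[ i < m ] ∑[ a < p ] F (i * p + a)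
∑-blocks zero    p F = refl
∑-blocks (suc m) p F = begin
  ∑< (p + m * p) F                                         ≡⟨ cong (λ n → ∑< n F) (+-comm p (m * p)) ⟩
  ∑< (m * p + p) F                                         ≡⟨ ∑-split (m * p) p F ⟩
  ∑< (m * p) F + ∑[ a < p ] F (m * p + a)                  ≡⟨ cong (_+ ∑[ a < p ] F (m * p + a)) (∑-blocks m p F) ⟩
  ∑[ i < m ] ∑[ a < p ] F (i * p + a) + ∑[ a < p ] F (m * p + a) ∎
  where open ≡-Reasoning

Periodic : ℕ → (ℕ → ℕ) → Set
Periodic p F = ∀ k → F (k + p) ≡ F k

periodic-+* : ∀ {p F} → Periodic p F → ∀ m k → F (k + m * p) ≡ F k
periodic-+* {p} {F} per zero    k = cong F (+-identityʳ k)
periodic-+* {p} {F} per (suc m) k = begin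
  F (k + (p + m * p)) ≡⟨ cong F (trans (sym (+-assoc k p (m * p))) (cong (_+ m * p) (+-comm k p))) ⟩
  F (p + k + m * p)   ≡⟨ periodic-+* per m (p + k) ⟩
  F (p + k)           ≡⟨ cong F (+-comm p k) ⟩
  F (k + p)           ≡⟨ per k ⟩
  F k                 ∎
  where open ≡-Reasoning

periodic-shift : ∀ {p F} → Periodic p F → ∀ t → Periodic p (λ k → F (k + t))
periodic-shift {p} {F} per t k = trans (cong F (xy∙z≈xz∙y k p t)) (per (k + t))

∑-periodic-* : ∀ {p F} → Periodic p F → ∀ m → ∑< (m * p) F ≡ m * ∑< p F
∑-periodic-* {p} {F} per m = trans (∑-blocks m p F) (trans (∑-cong m (λ i → ∑-cong p (λ a → block i a))) (∑-const m (∑< p F)))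
  where
  block : ∀ i a → F (i * p + a) ≡ F a
  block i a = trans (cong F (+-comm (i * p) a)) (periodic-+* per i a)

∑-rotate : ∀ {p F} → Periodic p F → ∀ t → ∑[ k < p ] F (k + t) ≡ ∑< p F
∑-rotate {p} {F} per zero    = ∑-cong p (λ k → cong F (+-identityʳ k))
∑-rotate {p} {F} per (suc t) = begin
  ∑[ k < p ] F (k + suc t)                   ≡⟨ ∑-cong p (λ k → cong F (+-suc k t)) ⟩
  ∑[ k < p ] G (suc k)                       ≡⟨ +-cancelʳ-≡ (G 0) _ _ rotate₁ ⟩
  ∑< p G                                     ≡⟨ ∑-rotate per t ⟩
  ∑< p F                                     ∎
  where
  open ≡-Reasoning
  G : ℕ → ℕ
  G k = F (k + t)
  rotate₁ : ∑[ k < p ] G (suc k) + G 0 ≡ ∑< p G + G 0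
  rotate₁ = begin
    ∑[ k < p ] G (suc k) + G 0   ≡⟨ +-comm _ (G 0) ⟩
    G 0 + ∑[ k < p ] G (suc k)   ≡⟨ ∑-head p G ⟨
    ∑< p G + G p                 ≡⟨ cong (∑< p G +_) (periodic-shift per t 0) ⟩
    ∑< p G + G 0                 ∎

∑-two-periods : ∀ {p p′ F} → Periodic p F → Periodic p′ F → p′ * ∑< p F ≡ p * ∑< p′ F
∑-two-periods {p} {p′} {F} per per′ =
  trans (sym (∑-periodic-* per p′)) (trans (cong (λ n → ∑< n F) (*-comm p′ p)) (∑-periodic-* per′ p))

sum-applyUpTo : ∀ n (F : ℕ → ℕ) → sum (applyUpTo F n) ≡ ∑< n F
sum-applyUpTo zero    F = refl
sum-applyUpTo (suc n) F = trans (cong (F 0 +_) (sum-applyUpTo n (λ k → F (suc k)))) (sym (∑-head n F))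

-- Indicators and reindexing

𝟙[_<_] : ℕ → ℕ → ℕ
𝟙[ zero  < zero  ] = 0
𝟙[ zero  < suc b ] = 1
𝟙[ suc a < zero  ] = 0
𝟙[ suc a < suc b ] = 𝟙[ a < b ]

𝟙<-yes : ∀ {a b} → a < b → 𝟙[ a < b ] ≡ 1
𝟙<-yes {zero}  {suc b} _       = refl
𝟙<-yes {suc a} {suc b} (s≤s p) = 𝟙<-yes p

𝟙<-no : ∀ {a b} → b ≤ a → 𝟙[ a < b ] ≡ 0
𝟙<-no {zero}  {zero}  _       = refl
𝟙<-no {suc a} {zero}  _       = refl
𝟙<-no {suc a} {suc b} (s≤s p) = 𝟙<-no p

∑-𝟙< : ∀ n {v} → v ≤ n → ∑[ t < n ] 𝟙[ t < v ] ≡ v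
∑-𝟙< zero    z≤n = refl
∑-𝟙< (suc n) {v} v≤1+n with m≤n⇒m<n∨m≡n v≤1+n
... | inj₁ (s≤s v≤n) = trans (cong₂ _+_ (∑-𝟙< n v≤n) (𝟙<-no v≤n)) (+-identityʳ v)
... | inj₂ refl      = begin
  ∑[ t < n ] 𝟙[ t < suc n ] + 𝟙[ n < suc n ] ≡⟨ cong₂ _+_ (∑-cong-< n (λ t t<n → 𝟙<-yes (m<n⇒m<1+n t<n))) (𝟙<-yes (n<1+n n)) ⟩
  ∑[ t < n ] 1 + 1                            ≡⟨ cong (_+ 1) (trans (∑-const n 1) (*-identityʳ n)) ⟩
  n + 1                                       ≡⟨ +-comm n 1 ⟩
  suc n                                       ∎
  where open ≡-Reasoning

δ : ℕ → ℕ → ℕ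
δ zero    zero    = 1
δ zero    (suc b) = 0
δ (suc a) zero    = 0
δ (suc a) (suc b) = δ a b

δ-refl : ∀ a → δ a a ≡ 1
δ-refl zero    = refl
δ-refl (suc a) = δ-refl a

δ-≢ : ∀ {a b} → a ≢ b → δ a b ≡ 0
δ-≢ {zero}  {zero}  a≢b = ⊥-elim (a≢b refl)
δ-≢ {zero}  {suc b} a≢b = refl
δ-≢ {suc a} {zero}  a≢b = refl
δ-≢ {suc a} {suc b} a≢b = δ-≢ (λ a≡b → a≢b (cong suc a≡b))

δ-sym : ∀ a b → δ a b ≡ δ b a
δ-sym zero    zero    = refl
δ-sym zero    (suc b) = refl
δ-sym (suc a) zero    = refl
δ-sym (suc a) (suc b) = δ-sym a b

δ-≡ : ∀ {a b} → a ≡ b → δ a b ≡ 1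
δ-≡ {a} refl = δ-refl a

∑-δ : ∀ n {a} (G : ℕ → ℕ) → a < n → ∑[ k < n ] (δ a k * G k) ≡ G a
∑-δ (suc n) {a} G a<1+n with a ≟ n
... | yes refl = begin
  ∑[ k < a ] (δ a k * G k) + δ a a * G a ≡⟨ cong₂ _+_ (∑-cong-< a (λ k k<a → cong (_* G k) (δ-≢ (>⇒≢ k<a)))) (cong (_* G a) (δ-refl a)) ⟩
  ∑[ k < a ] 0 + (G a + 0)               ≡⟨ cong₂ _+_ (∑-zero a) (+-identityʳ (G a)) ⟩
  G a                                    ∎
  where open ≡-Reasoning
... | no a≢n = trans (cong₂ _+_ (∑-δ n G (≤∧≢⇒< (≤-pred a<1+n) a≢n)) (cong (_* G n) (δ-≢ a≢n))) (+-identityʳ (G a))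

∑-δ-one : ∀ n {a} → a < n → ∑[ k < n ] δ a k ≡ 1
∑-δ-one n a<n = trans (∑-cong n (λ k → sym (*-identityʳ _))) (∑-δ n (λ _ → 1) a<n)

InjectiveBelow : ℕ → (ℕ → ℕ) → Set
InjectiveBelow n h = ∀ {m m'} → m < n → m' < n → h m ≡ h m' → m ≡ m'

∑-δ-injective : ∀ n {h} → InjectiveBelow n h → ∀ s → ∑[ m < n ] δ (h m) s ≤ 1
∑-δ-injective zero    inj s = z≤n
∑-δ-injective (suc n) {h} inj s with h n ≟ s
... | yes refl = ≤-reflexive (cong₂ _+_ earlier-miss (δ-refl s))
  where
  earlier-miss : ∑[ m < n ] δ (h m) (h n) ≡ 0
  earlier-miss = trans (∑-cong-< n (λ m m<n → δ-≢ (λ e → <⇒≢ m<n (inj (m<n⇒m<1+n m<n) ≤-refl e)))) (∑-zero n)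
... | no hn≢s = subst (_≤ 1) (sym (trans (cong (∑[ m < n ] δ (h m) s +_) (δ-≢ hn≢s)) (+-identityʳ _)))
                      (∑-δ-injective n (λ m<n m'<n → inj (m<n⇒m<1+n m<n) (m<n⇒m<1+n m'<n)) s)

∑-bounded : ∀ n {C b} → (∀ s → s < n → C s ≤ b) → ∑< n C ≤ n * b
∑-bounded zero    C≤b = z≤n
∑-bounded (suc n) {b = b} C≤b = ≤-trans (+-mono-≤ (∑-bounded n (λ s s<n → C≤b s (m<n⇒m<1+n s<n))) (C≤b n ≤-refl)) (≤-reflexive (+-comm (n * b) b))

∑-saturated : ∀ n {C} → (∀ s → s < n → C s ≤ 1) → ∑< n C ≡ n → ∀ s → s < n → C s ≡ 1
∑-saturated (suc n) {C} C≤1 total s s<1+n =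
  [ (λ s<n → ∑-saturated n C≤1′ front s s<n) , (λ { refl → last≡1 }) ]′ (m<1+n⇒m<n∨m≡n s<1+n)
  where
  open ≤-Reasoning
  C≤1′ : ∀ s → s < n → C s ≤ 1
  C≤1′ s s<n = C≤1 s (m<n⇒m<1+n s<n)
  last≡1 : C n ≡ 1
  last≡1 = ≤-antisym (C≤1 n ≤-refl) (+-cancelˡ-≤ n 1 (C n) (begin
    n + 1         ≡⟨ +-comm n 1 ⟩
    suc n         ≡⟨ total ⟨
    ∑< n C + C n  ≤⟨ +-monoˡ-≤ (C n) (≤-trans (∑-bounded n C≤1′) (≤-reflexive (*-identityʳ n))) ⟩
    n + C n       ∎))
  front : ∑< n C ≡ n
  front = +-cancelʳ-≡ 1 _ _ (trans (cong (∑< n C +_) (sym last≡1)) (trans total (+-comm 1 n)))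

∑-reindex-injective : ∀ n {h} (G : ℕ → ℕ) → (∀ m → m < n → h m < n) → InjectiveBelow n h →
                      ∑[ m < n ] G (h m) ≡ ∑< n G
∑-reindex-injective n {h} G h<n inj = begin
  ∑[ m < n ] G (h m)                        ≡⟨ ∑-cong-< n (λ m m<n → sym (∑-δ n G (h<n m m<n))) ⟩
  ∑[ m < n ] ∑[ s < n ] (δ (h m) s * G s)   ≡⟨ ∑-swap n n (λ m s → δ (h m) s * G s) ⟩
  ∑[ s < n ] ∑[ m < n ] (δ (h m) s * G s)   ≡⟨ ∑-cong n (λ s → ∑-*ʳ n (G s) (λ m → δ (h m) s)) ⟩
  ∑[ s < n ] (hits s * G s)                 ≡⟨ ∑-cong-< n (λ s s<n → trans (cong (_* G s) (hits≡1 s s<n)) (*-identityˡ (G s))) ⟩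
  ∑< n G                                    ∎
  where
  open ≡-Reasoning
  hits : ℕ → ℕ
  hits s = ∑[ m < n ] δ (h m) s
  total : ∑< n hits ≡ n
  total = begin
    ∑[ s < n ] ∑[ m < n ] δ (h m) s   ≡⟨ ∑-swap n n (λ s m → δ (h m) s) ⟩
    ∑[ m < n ] ∑[ s < n ] δ (h m) s   ≡⟨ ∑-cong-< n (λ m m<n → ∑-δ-one n (h<n m m<n)) ⟩
    ∑[ m < n ] 1                      ≡⟨ trans (∑-const n 1) (*-identityʳ n) ⟩
    n                                 ∎
  hits≡1 : ∀ s → s < n → hits s ≡ 1
  hits≡1 = ∑-saturated n (λ s _ → ∑-δ-injective n inj s) total

%-≡⇒∣∸ : ∀ n .{{_ : NonZero n}} a b → a % n ≡ b % n → n ∣ a ∸ b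
%-≡⇒∣∸ n a b eq = divides (a / n ∸ b / n) (begin
  a ∸ b                                        ≡⟨ cong₂ _∸_ (m≡m%n+[m/n]*n a n) (m≡m%n+[m/n]*n b n) ⟩
  (a % n + a / n * n) ∸ (b % n + b / n * n)    ≡⟨ cong (λ z → (a % n + a / n * n) ∸ (z + b / n * n)) (sym eq) ⟩
  (a % n + a / n * n) ∸ (a % n + b / n * n)    ≡⟨ [m+n]∸[m+o]≡n∸o (a % n) (a / n * n) (b / n * n) ⟩
  a / n * n ∸ b / n * n                        ≡⟨ *-distribʳ-∸ n (a / n) (b / n) ⟨
  (a / n ∸ b / n) * n                          ∎)
  where open ≡-Reasoning

coprime-step-injective : ∀ τ .{{_ : NonZero τ}} {r} j → Coprime τ r → InjectiveBelow τ (λ m → (j + m * r) % τ)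
coprime-step-injective τ {r} j cop {m} {m'} m<τ m'<τ eq =
  [ (λ m≤m' → ordered m≤m' m'<τ eq) , (λ m'≤m → sym (ordered m'≤m m<τ (sym eq))) ]′ (≤-total m m')
  where
  ordered : ∀ {m m'} → m ≤ m' → m' < τ → (j + m * r) % τ ≡ (j + m' * r) % τ → m ≡ m'
  ordered {m} {m'} m≤m' m'<τ eq = ≤-antisym m≤m' (m∸n≡0⇒m≤n gap≡0)
    where
    gap : (j + m' * r) ∸ (j + m * r) ≡ r * (m' ∸ m)
    gap = trans ([m+n]∸[m+o]≡n∸o j (m' * r) (m * r)) (trans (sym (*-distribʳ-∸ r m' m)) (*-comm (m' ∸ m) r))
    τ∣gap : τ ∣ m' ∸ m
    τ∣gap = coprime-divisor cop (subst (τ ∣_) gap (%-≡⇒∣∸ τ _ _ (sym eq)))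
    gap≡0 : m' ∸ m ≡ 0
    gap≡0 = trans (sym (m<n⇒m%n≡m (≤-<-trans (m∸n≤m m' m) m'<τ))) (n∣m⇒m%n≡0 _ τ τ∣gap)

periodic-% : ∀ {τ} .{{_ : NonZero τ}} {G} → Periodic τ G → ∀ n → G n ≡ G (n % τ)
periodic-% {τ} {G} per n = trans (cong G (m≡m%n+[m/n]*n n τ)) (periodic-+* per (n / τ) (n % τ))

∑-coprime-step : ∀ τ .{{_ : NonZero τ}} {r G} j → Periodic τ G → Coprime τ r →
                 ∑[ m < τ ] G (j + m * r) ≡ ∑< τ G
∑-coprime-step τ {r} {G} j per cop =
  trans (∑-cong τ (λ m → periodic-% per (j + m * r)))
        (∑-reindex-injective τ G (λ m _ → m%n<n (j + m * r) τ) (coprime-step-injective τ j cop))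

⌊⌋-true : ∀ {X : Set} (d : Dec X) → X → ⌊ d ⌋ ≡ true
⌊⌋-true d x = trans (isYes≗does d) (dec-true d x)

⌊⌋-true⁻¹ : ∀ {X : Set} (d : Dec X) → ⌊ d ⌋ ≡ true → X
⌊⌋-true⁻¹ (yes x) _  = x
⌊⌋-true⁻¹ (no _)  ()

⌊⌋-false⁻¹ : ∀ {X : Set} (d : Dec X) → ⌊ d ⌋ ≡ false → ¬ X
⌊⌋-false⁻¹ (yes _)  ()
⌊⌋-false⁻¹ (no ¬x) _ = ¬x

⌊⌋-⇔ : ∀ {X Y : Set} → (X → Y) → (Y → X) → (d : Dec X) (e : Dec Y) → ⌊ d ⌋ ≡ ⌊ e ⌋
⌊⌋-⇔ to from d e = trans (isYes≗does d) (trans (does-⇔ (mk⇔ to from) d e) (sym (isYes≗does e)))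

if-⌊⌋-else-0 : ∀ {X : Set} (d : Dec X) {v} → (¬ X → v ≡ 0) → (if ⌊ d ⌋ then v else 0) ≡ v
if-⌊⌋-else-0 (yes _)  _   = refl
if-⌊⌋-else-0 (no ¬x) v≡0 = sym (v≡0 ¬x)

-- Promotion

InRange : ∀ {n} → ℕ → (Fin n → ℕ) → Set
InRange q g = ∀ y → 1 ≤ g y × g y ≤ q

module Promotion (P : FinPoset) where
  open FinPoset P

  -- These decisions compute to the two Boolean tests of slideStep, so slideStep P i g x is
  -- definitionally  if does (fills? i g x) then i else if does (vacates? i g x) then 0 else g x.
  record Fills (i : ℕ) (g : Labeling P) (x : Fin size) : Set where
    constructor mkFills
    field
      isBox : g x ≡ 0
      above : T (coverAboveHas P g i x)

  record Vacates (i : ℕ) (g : Labeling P) (x : Fin size) : Set where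
    constructor mkVacates
    field
      isLabel : g x ≡ i
      below   : T (coverBelowHas P g 0 x)

  fills? : ∀ i g x → Dec (Fills i g x)
  fills? i g x = map′ (λ (b , a) → mkFills b a) (λ (mkFills b a) → b , a) ((g x ≟ 0) ×-dec T? (coverAboveHas P g i x))

  vacates? : ∀ i g x → Dec (Vacates i g x)
  vacates? i g x = map′ (λ (l , b) → mkVacates l b) (λ (mkVacates l b) → l , b) ((g x ≟ i) ×-dec T? (coverBelowHas P g 0 x))

  fills : ∀ {i g x y} → g x ≡ 0 → x ⋖ y → g y ≡ i → Fills i g x
  fills gx≡0 x⋖y gy≡i = mkFills gx≡0 (fromWitness (_ , x⋖y , gy≡i))

  vacates : ∀ {i g x z} → g x ≡ i → z ⋖ x → g z ≡ 0 → Vacates i g x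
  vacates gx≡i z⋖x gz≡0 = mkVacates gx≡i (fromWitness (_ , z⋖x , gz≡0))

  slide-fills : ∀ {i g x} → Fills i g x → slideStep P i g x ≡ i
  slide-fills {i} {g} {x} F = cong (λ b → if b then i else if does (vacates? i g x) then 0 else g x) (dec-true (fills? i g x) F)

  slide-vacates : ∀ {i g x} → ¬ Fills i g x → Vacates i g x → slideStep P i g x ≡ 0
  slide-vacates {i} {g} {x} ¬F V =
    cong₂ (λ b b′ → if b then i else if b′ then 0 else g x) (dec-false (fills? i g x) ¬F) (dec-true (vacates? i g x) V)

  slide-stays : ∀ {i g x} → ¬ Fills i g x → ¬ Vacates i g x → slideStep P i g x ≡ g x
  slide-stays {i} {g} {x} ¬F ¬V =
    cong₂ (λ b b′ → if b then i else if b′ then 0 else g x) (dec-false (fills? i g x) ¬F) (dec-false (vacates? i g x) ¬V)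

  module _ (ψ : ℕ → ℕ) {i : ℕ} {g g′ : Labeling P} (ψ0≡0 : ψ 0 ≡ 0) (g′≗ψg : g′ ≗ (λ y → ψ (g y)))
           (back₀ : ∀ y → g′ y ≡ 0 → g y ≡ 0) (backᵢ : ∀ y → g′ y ≡ ψ i → g y ≡ i) where

    private
      forwardF : ∀ {x} → Fills i g x → Fills (ψ i) g′ x
      forwardF {x} (mkFills gx≡0 t) with toWitness t
      ... | y , x⋖y , gy≡i = fills (trans (g′≗ψg x) (trans (cong ψ gx≡0) ψ0≡0)) x⋖y (trans (g′≗ψg y) (cong ψ gy≡i))

      backF : ∀ {x} → Fills (ψ i) g′ x → Fills i g x
      backF {x} (mkFills g′x≡0 t) with toWitness t
      ... | y , x⋖y , g′y≡ψi = fills (back₀ x g′x≡0) x⋖y (backᵢ y g′y≡ψi)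

      forwardV : ∀ {x} → Vacates i g x → Vacates (ψ i) g′ x
      forwardV {x} (mkVacates gx≡i t) with toWitness t
      ... | z , z⋖x , gz≡0 = vacates (trans (g′≗ψg x) (cong ψ gx≡i)) z⋖x (trans (g′≗ψg z) (trans (cong ψ gz≡0) ψ0≡0))

      backV : ∀ {x} → Vacates (ψ i) g′ x → Vacates i g x
      backV {x} (mkVacates g′x≡ψi t) with toWitness t
      ... | z , z⋖x , g′z≡0 = vacates (backᵢ x g′x≡ψi) z⋖x (back₀ z g′z≡0)

    slide-relabel : ∀ x → slideStep P (ψ i) g′ x ≡ ψ (slideStep P i g x)
    slide-relabel x with fills? i g x | vacates? i g x
    ... | yes F  | _     = trans (slide-fills (forwardF F)) (cong ψ (sym (slide-fills F)))
    ... | no ¬F  | yes V = trans (slide-vacates (¬F ∘ backF) (forwardV V)) (trans (sym ψ0≡0) (cong ψ (sym (slide-vacates ¬F V))))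
    ... | no ¬F  | no ¬V = trans (slide-stays (¬F ∘ backF) (¬V ∘ backV)) (trans (g′≗ψg x) (cong ψ (sym (slide-stays ¬F ¬V))))

  slide-cong : ∀ i {g g′} → g ≗ g′ → slideStep P i g ≗ slideStep P i g′
  slide-cong i {g} {g′} g≗g′ x =
    sym (slide-relabel (λ v → v) refl (λ y → sym (g≗g′ y)) (λ y e → trans (g≗g′ y) e) (λ y e → trans (g≗g′ y) e) x)

  slide-values⊆ : ∀ i g x → ∃ λ y → g y ≡ slideStep P i g x
  slide-values⊆ i g x with fills? i g x | vacates? i g x
  ... | yes F@(mkFills _ t) | _ with toWitness t
  ...   | y , _ , gy≡i = y , trans gy≡i (sym (slide-fills F))
  slide-values⊆ i g x | no ¬F | yes V@(mkVacates _ t) with toWitness t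
  ...   | z , _ , gz≡0 = z , trans gz≡0 (sym (slide-vacates ¬F V))
  slide-values⊆ i g x | no ¬F | no ¬V = x , sym (slide-stays ¬F ¬V)

  slide-values⊇ : ∀ i g → i ≢ 0 → ∀ y → ∃ λ x → slideStep P i g x ≡ g y
  slide-values⊇ i g i≢0 y with g y ≟ i | g y ≟ 0
  ... | yes gy≡i | _ with vacates? i g y
  ...   | yes (mkVacates _ t) with toWitness t
  ...     | z , z⋖y , gz≡0 = z , trans (slide-fills (fills gz≡0 z⋖y gy≡i)) (sym gy≡i)
  slide-values⊇ i g i≢0 y | yes gy≡i | _ | no ¬V =
    y , slide-stays {i} {g} (λ (mkFills gy≡0 _) → i≢0 (trans (sym gy≡i) gy≡0)) ¬V
  slide-values⊇ i g i≢0 y | no gy≢i | yes gy≡0 with fills? i g y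
  ...   | yes (mkFills _ t) with toWitness t
  ...     | w , y⋖w , gw≡i = w , trans (slide-vacates (λ (mkFills gw≡0 _) → i≢0 (trans (sym gw≡i) gw≡0)) (vacates gw≡i y⋖w gy≡0)) (sym gy≡0)
  slide-values⊇ i g i≢0 y | no gy≢i | yes gy≡0 | no ¬F =
    y , slide-stays {i} {g} ¬F (λ (mkVacates gy≡i _) → gy≢i gy≡i)
  slide-values⊇ i g i≢0 y | no gy≢i | no gy≢0 =
    y , slide-stays {i} {g} (λ (mkFills gy≡0 _) → gy≢0 gy≡0) (λ (mkVacates gy≡i _) → gy≢i gy≡i)

  slide-absent : ∀ i g → (∀ y → g y ≢ i) → slideStep P i g ≗ g
  slide-absent i g absent x = slide-stays {i} {g} ¬F (λ (mkVacates gx≡i _) → absent x gx≡i)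
    where
    ¬F : ¬ Fills i g x
    ¬F (mkFills _ t) with toWitness t
    ... | y , _ , gy≡i = absent y gy≡i

  slide-boxless : ∀ i g → (∀ y → g y ≢ 0) → slideStep P i g ≗ g
  slide-boxless i g boxless x = slide-stays {i} {g} (λ (mkFills gx≡0 _) → boxless x gx≡0) ¬V
    where
    ¬V : ¬ Vacates i g x
    ¬V (mkVacates _ t) with toWitness t
    ... | z , _ , gz≡0 = boxless z gz≡0

  slides-cong : ∀ m {g g′} → g ≗ g′ → slidesUpTo P m g ≗ slidesUpTo P m g′
  slides-cong zero          g≗g′ = g≗g′
  slides-cong (suc zero)    g≗g′ = g≗g′
  slides-cong (suc (suc m)) g≗g′ = slide-cong (suc (suc m)) (slides-cong (suc m) g≗g′)

  slides-values⊆ : ∀ m g x → ∃ λ y → g y ≡ slidesUpTo P m g x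
  slides-values⊆ zero          g x = x , refl
  slides-values⊆ (suc zero)    g x = x , refl
  slides-values⊆ (suc (suc m)) g x =
    let y , e  = slide-values⊆ (suc (suc m)) (slidesUpTo P (suc m) g) x
        z , e′ = slides-values⊆ (suc m) g y
    in z , trans e′ e

  slides-values⊇ : ∀ m g y → ∃ λ x → slidesUpTo P m g x ≡ g y
  slides-values⊇ zero          g y = y , refl
  slides-values⊇ (suc zero)    g y = y , refl
  slides-values⊇ (suc (suc m)) g y =
    let x′ , e = slides-values⊇ (suc m) g y
        x , e′ = slide-values⊇ (suc (suc m)) (slidesUpTo P (suc m) g) (λ ()) x′
    in x , trans e′ e

  slides-boxless : ∀ m g → (∀ y → g y ≢ 0) → slidesUpTo P m g ≗ g
  slides-boxless zero          g boxless x = refl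
  slides-boxless (suc zero)    g boxless x = refl
  slides-boxless (suc (suc m)) g boxless x =
    trans (slide-boxless (suc (suc m)) _ (λ y e → boxless y (trans (sym (slides-boxless (suc m) g boxless y)) e)) x)
          (slides-boxless (suc m) g boxless x)

  -- The first and last stage of pro (a box is the label 0): pro P q f x is definitionally
  -- fillBoxes q (slid q f x).
  boxOnes : Labeling P → Labeling P
  boxOnes f x = if f x ≡ᵇ 1 then 0 else f x

  fillBoxes : ℕ → ℕ → ℕ
  fillBoxes q v = if v ≡ᵇ 0 then q else v ∸ 1

  slid : ℕ → Labeling P → Labeling P
  slid q f = slidesUpTo P q (boxOnes f)

  boxOnes-one : ∀ {f x} → f x ≡ 1 → boxOnes f x ≡ 0
  boxOnes-one {f} {x} e = cong (λ b → if b then 0 else f x) (dec-true (f x ≟ 1) e)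

  boxOnes-other : ∀ {f x} → f x ≢ 1 → boxOnes f x ≡ f x
  boxOnes-other {f} {x} ne = cong (λ b → if b then 0 else f x) (dec-false (f x ≟ 1) ne)

  boxOnes-cong : ∀ {f f′} → f ≗ f′ → boxOnes f ≗ boxOnes f′
  boxOnes-cong f≗f′ x = cong (λ v → if v ≡ᵇ 1 then 0 else v) (f≗f′ x)

  fillBoxes-box : ∀ {q v} → v ≡ 0 → fillBoxes q v ≡ q
  fillBoxes-box refl = refl

  fillBoxes-label : ∀ {q v} → 1 ≤ v → fillBoxes q v ≡ v ∸ 1
  fillBoxes-label {v = suc v} _ = refl

  pro-cong : ∀ q {f f′} → f ≗ f′ → pro P q f ≗ pro P q f′
  pro-cong q f≗f′ x = cong (fillBoxes q) (slides-cong q (boxOnes-cong f≗f′) x)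

  proIter-cong : ∀ q k {f f′} → f ≗ f′ → proIter P q k f ≗ proIter P q k f′
  proIter-cong q zero    f≗f′ = f≗f′
  proIter-cong q (suc k) f≗f′ = pro-cong q (proIter-cong q k f≗f′)

  proIter-+ : ∀ q a b f → proIter P q (a + b) f ≗ proIter P q a (proIter P q b f)
  proIter-+ q zero    b f x = refl
  proIter-+ q (suc a) b f   = pro-cong q (proIter-+ q a b f)

  SlidValue : Labeling P → ℕ → Set
  SlidValue f v = (v ≡ 0 × ∃ λ y → f y ≡ 1) ⊎ (2 ≤ v × ∃ λ y → f y ≡ v)

  slid-values : ∀ m {q f} → InRange q f → ∀ x → SlidValue f (slidesUpTo P m (boxOnes f) x)
  slid-values m {f = f} range x with slides-values⊆ m (boxOnes f) x
  ... | y , e with f y ≟ 1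
  ...   | yes fy≡1 = inj₁ (trans (sym e) (boxOnes-one {f} {y} fy≡1) , y , fy≡1)
  ...   | no fy≢1  = inj₂ (subst (2 ≤_) fy≡ (≤∧≢⇒< (proj₁ (range y)) (fy≢1 ∘ sym)) , y , fy≡)
    where
    fy≡ : f y ≡ slidesUpTo P m (boxOnes f) x
    fy≡ = trans (sym (boxOnes-other {f} {y} fy≢1)) e

  pro-range : ∀ {q f} → InRange q f → InRange q (pro P q f)
  pro-range {q} {f} range x with slid-values q range x
  ... | inj₁ (box , _) = subst (λ v → 1 ≤ v × v ≤ q) (sym (fillBoxes-box box)) (≤-trans (proj₁ (range x)) (proj₂ (range x)) , ≤-refl)
  ... | inj₂ (2≤v , y , fy≡v) = subst (λ v → 1 ≤ v × v ≤ q) (sym (fillBoxes-label (≤-trans (n≤1+n 1) 2≤v)))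
                                      (∸-monoˡ-≤ 1 2≤v , ≤-trans (m∸n≤m _ 1) (subst (_≤ q) fy≡v (proj₂ (range y))))

  used-true : ∀ f {x i} → f x ≡ i → used P f i ≡ true
  used-true f {x} {i} fx≡i = ⌊⌋-true (FinP.any? (λ y → f y ≟ i)) (x , fx≡i)

  used-false⁻¹ : ∀ f {i} → used P f i ≡ false → ∀ x → f x ≢ i
  used-false⁻¹ f {i} unused x fx≡i = ⌊⌋-false⁻¹ (FinP.any? (λ y → f y ≟ i)) unused (x , fx≡i)

  used-⇔ : ∀ f g {i j} → (∃ (λ x → f x ≡ i) → ∃ (λ x → g x ≡ j)) → (∃ (λ x → g x ≡ j) → ∃ (λ x → f x ≡ i)) →
           used P f i ≡ used P g j
  used-⇔ f g {i} {j} to from = ⌊⌋-⇔ to from (FinP.any? (λ y → f y ≟ i)) (FinP.any? (λ y → g y ≟ j))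

  used-pro : ∀ {q f} → InRange q f → ∀ {w} → 1 ≤ w → w < q → used P (pro P q f) w ≡ used P f (suc w)
  used-pro {q} {f} range {w} 1≤w w<q = used-⇔ (pro P q f) f to from
    where
    unshift : ∀ {v} → 1 ≤ v → v ∸ 1 ≡ w → v ≡ suc w
    unshift {suc v} _ refl = refl
    to : ∃ (λ x → pro P q f x ≡ w) → ∃ (λ x → f x ≡ suc w)
    to (x , e) with slid-values q range x
    ... | inj₁ (box , _)        = ⊥-elim (<⇒≢ w<q (trans (sym e) (fillBoxes-box box)))
    ... | inj₂ (2≤v , y , fy≡v) = y , trans fy≡v (unshift 1≤v (trans (sym (fillBoxes-label 1≤v)) e))
      where 1≤v = ≤-trans (n≤1+n 1) 2≤v
    from : ∃ (λ x → f x ≡ suc w) → ∃ (λ x → pro P q f x ≡ w)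
    from (y , fy≡1+w) =
      let x , e = slides-values⊇ q (boxOnes f) y
      in x , cong (fillBoxes q) (trans e (trans (boxOnes-other {f} {y} (λ fy≡1 → <⇒≢ 1≤w (sym (suc-injective (trans (sym fy≡1+w) fy≡1))))) fy≡1+w))

  used-pro-top : ∀ {q f} → InRange q f → used P (pro P q f) q ≡ used P f 1
  used-pro-top {q} {f} range = used-⇔ (pro P q f) f to from
    where
    to : ∃ (λ x → pro P q f x ≡ q) → ∃ (λ x → f x ≡ 1)
    to (x , e) with slid-values q range x
    ... | inj₁ (_ , one)        = one
    ... | inj₂ (2≤v , y , fy≡v) = ⊥-elim (<⇒≢ below-q (trans (sym (fillBoxes-label 1≤v)) e))
      where
      1≤v = ≤-trans (n≤1+n 1) 2≤v
      below-q : slid q f x ∸ 1 < q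
      below-q = <-≤-trans (∸-monoʳ-< {o = 0} (s≤s z≤n) 1≤v) (subst (_≤ q) fy≡v (proj₂ (range y)))
    from : ∃ (λ x → f x ≡ 1) → ∃ (λ x → pro P q f x ≡ q)
    from (y , fy≡1) =
      let x , e = slides-values⊇ q (boxOnes f) y
      in x , fillBoxes-box (trans e (boxOnes-one {f} {y} fy≡1))

  indicator-true : ∀ {b} → b ≡ true → indicator P b ≡ 1
  indicator-true refl = refl

  indicator-false : ∀ {b} → b ≡ false → indicator P b ≡ 0
  indicator-false refl = refl

  usedUpTo-mono : ∀ f {a} b → a ≤ b → usedUpTo P f a ≤ usedUpTo P f b
  usedUpTo-mono f zero    z≤n = ≤-refl
  usedUpTo-mono f {a} (suc b) a≤1+b with m≤n⇒m<n∨m≡n a≤1+b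
  ... | inj₁ (s≤s a≤b) = ≤-trans (usedUpTo-mono f b a≤b) (m≤m+n _ _)
  ... | inj₂ refl      = ≤-refl

  usedUpTo-strict : ∀ f {a b} → a < b → used P f b ≡ true → usedUpTo P f a < usedUpTo P f b
  usedUpTo-strict f {a} {suc b} (s≤s a≤b) b-used = begin-strict
    usedUpTo P f a                        ≤⟨ usedUpTo-mono f b a≤b ⟩
    usedUpTo P f b                        <⟨ n<1+n _ ⟩
    suc (usedUpTo P f b)                  ≡⟨ +-comm 1 _ ⟩
    usedUpTo P f b + 1                    ≡⟨ cong (usedUpTo P f b +_) (indicator-true b-used) ⟨
    usedUpTo P f (suc b)                  ∎
    where open ≤-Reasoning

  usedUpTo-injective : ∀ f {a b} → used P f a ≡ true → used P f b ≡ true → usedUpTo P f a ≡ usedUpTo P f b → a ≡ b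
  usedUpTo-injective f {a} {b} a-used b-used e with <-cmp a b
  ... | tri< a<b _ _ = ⊥-elim (<⇒≢ (usedUpTo-strict f a<b b-used) e)
  ... | tri≈ _ a≡b _ = a≡b
  ... | tri> _ _ b<a = ⊥-elim (<⇒≢ (usedUpTo-strict f b<a a-used) (sym e))

  usedUpTo-pro : ∀ {q f} → InRange q f → ∀ w → w < q →
                 usedUpTo P (pro P q f) w + indicator P (used P f 1) ≡ usedUpTo P f (suc w)
  usedUpTo-pro         range zero    _     = refl
  usedUpTo-pro {q} {f} range (suc w) 1+w<q = begin
    usedUpTo P f′ w + indicator P (used P f′ (suc w)) + i₁   ≡⟨ xy∙z≈xz∙y (usedUpTo P f′ w) _ i₁ ⟩
    usedUpTo P f′ w + i₁ + indicator P (used P f′ (suc w))   ≡⟨ cong₂ _+_ (usedUpTo-pro range w (<-trans (n<1+n w) 1+w<q))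
                                                                          (cong (indicator P) (used-pro range (s≤s z≤n) 1+w<q)) ⟩
    usedUpTo P f (suc (suc w))                                ∎
    where
    open ≡-Reasoning
    f′ = pro P q f
    i₁ = indicator P (used P f 1)

  numUsed-pro : ∀ {q f} → InRange q f → 1 ≤ q → numUsed P q (pro P q f) ≡ numUsed P q f
  numUsed-pro {suc q} {f} range _ =
    trans (cong (λ b → usedUpTo P (pro P (suc q) f) q + indicator P b) (used-pro-top range)) (usedUpTo-pro range q ≤-refl)

  deflate-pro-unused : ∀ {q f} → InRange q f → used P f 1 ≡ false → deflate P (pro P q f) ≗ deflate P f
  deflate-pro-unused {q} {f} range 1-unused x = begin
    usedUpTo P (pro P q f) (pro P q f x)                          ≡⟨ cong (usedUpTo P (pro P q f)) pro-x ⟩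
    usedUpTo P (pro P q f) (f x ∸ 1)                              ≡⟨ +-identityʳ _ ⟨
    usedUpTo P (pro P q f) (f x ∸ 1) + 0                          ≡⟨ cong (usedUpTo P (pro P q f) (f x ∸ 1) +_) (indicator-false 1-unused) ⟨
    usedUpTo P (pro P q f) (f x ∸ 1) + indicator P (used P f 1)   ≡⟨ usedUpTo-pro range (f x ∸ 1) fx∸1<q ⟩
    usedUpTo P f (suc (f x ∸ 1))                                  ≡⟨ cong (usedUpTo P f) (m+[n∸m]≡n 1≤fx) ⟩
    usedUpTo P f (f x)                                            ∎
    where
    open ≡-Reasoning
    1≤fx = proj₁ (range x)
    fx∸1<q = <-≤-trans (∸-monoʳ-< {o = 0} (s≤s z≤n) 1≤fx) (proj₂ (range x))
    unboxed : boxOnes f ≗ f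
    unboxed y = boxOnes-other {f} {y} (used-false⁻¹ f 1-unused y)
    pro-x : pro P q f x ≡ f x ∸ 1
    pro-x = trans (cong (fillBoxes q) (trans (slides-boxless q (boxOnes f) (λ y e → <⇒≢ (proj₁ (range y)) (sym (trans (sym (unboxed y)) e))) x) (unboxed x)))
                  (fillBoxes-label 1≤fx)

  boxOnes-deflate : ∀ {q f} → InRange q f → used P f 1 ≡ true → (λ x → usedUpTo P f (boxOnes f x)) ≗ boxOnes (deflate P f)
  boxOnes-deflate {q} {f} range 1-used x with f x ≟ 1
  ... | yes fx≡1 = trans (cong (usedUpTo P f) (boxOnes-one {f} {x} fx≡1))
                         (sym (boxOnes-one {deflate P f} {x} (trans (cong (usedUpTo P f) fx≡1) (indicator-true 1-used))))
  ... | no fx≢1  = trans (cong (usedUpTo P f) (boxOnes-other {f} {x} fx≢1))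
                         (sym (boxOnes-other {deflate P f} {x} (λ e → <⇒≢ deflated>1 (sym e))))
    where
    deflated>1 : 1 < deflate P f x
    deflated>1 = subst (_< deflate P f x) (indicator-true 1-used)
                   (usedUpTo-strict f (≤∧≢⇒< (proj₁ (range x)) (fx≢1 ∘ sym)) (used-true f refl))

  usedUpTo-slid≡0 : ∀ m {q f} → InRange q f → ∀ y →
                    usedUpTo P f (slidesUpTo P m (boxOnes f) y) ≡ 0 → slidesUpTo P m (boxOnes f) y ≡ 0
  usedUpTo-slid≡0 m {f = f} range y e with slid-values m range y
  ... | inj₁ (box , _)        = box
  ... | inj₂ (2≤v , z , fz≡v) = ⊥-elim (<⇒≢ (usedUpTo-strict f (≤-trans (n≤1+n 1) 2≤v) (used-true f fz≡v)) (sym e))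

  usedUpTo-slid-injective : ∀ m {q f} → InRange q f → ∀ {i} → 1 ≤ i → used P f i ≡ true → ∀ y →
                            usedUpTo P f (slidesUpTo P m (boxOnes f) y) ≡ usedUpTo P f i → slidesUpTo P m (boxOnes f) y ≡ i
  usedUpTo-slid-injective m {f = f} range 1≤i i-used y e with slid-values m range y
  ... | inj₁ (box , _)        = ⊥-elim (<⇒≢ (usedUpTo-strict f 1≤i i-used) (trans (cong (usedUpTo P f) (sym box)) e))
  ... | inj₂ (2≤v , z , fz≡v) = usedUpTo-injective f (used-true f fz≡v) i-used e

  -- Deflation relabels by the monotone map usedUpTo f, which is injective on the labels of f:
  -- slides of unused labels do nothing, and the slide of a used label i becomes the slide
  -- of its deflated label.
  slides-deflate : ∀ {q f} → InRange q f → used P f 1 ≡ true → ∀ k → suc k ≤ q →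
                   (λ x → usedUpTo P f (slidesUpTo P (suc k) (boxOnes f) x)) ≗ slidesUpTo P (usedUpTo P f (suc k)) (boxOnes (deflate P f))
  slides-deflate {q} {f} range 1-used zero _ x =
    trans (boxOnes-deflate range 1-used x) (cong (λ n → slidesUpTo P n (boxOnes (deflate P f)) x) (sym (indicator-true 1-used)))
  slides-deflate {q} {f} range 1-used (suc k) 2+k≤q x = by-usage (used P f i) refl
    where
    open ≡-Reasoning
    i = suc (suc k)
    h = slidesUpTo P (suc k) (boxOnes f)
    c = usedUpTo P f (suc k)
    f̄ = deflate P f
    IH : (λ y → usedUpTo P f (h y)) ≗ slidesUpTo P c (boxOnes f̄)
    IH = slides-deflate range 1-used k (<⇒≤ 2+k≤q)
    by-usage : ∀ b → used P f i ≡ b → usedUpTo P f (slideStep P i h x) ≡ slidesUpTo P (usedUpTo P f i) (boxOnes f̄) x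
    by-usage true i-used = begin
      usedUpTo P f (slideStep P i h x)                              ≡⟨ slide-relabel (usedUpTo P f) refl (λ _ → refl)
                                                                         (usedUpTo-slid≡0 (suc k) range)
                                                                         (usedUpTo-slid-injective (suc k) range (s≤s z≤n) i-used) x ⟨
      slideStep P (usedUpTo P f i) (λ y → usedUpTo P f (h y)) x     ≡⟨ slide-cong (usedUpTo P f i) IH x ⟩
      slideStep P (usedUpTo P f i) (slidesUpTo P c (boxOnes f̄)) x   ≡⟨ cong (λ n → slideStep P n (slidesUpTo P c (boxOnes f̄)) x) i↦1+c ⟩
      slideStep P (suc c) (slidesUpTo P c (boxOnes f̄)) x            ≡⟨ slides-suc c≥1 ⟨
      slidesUpTo P (suc c) (boxOnes f̄) x                            ≡⟨ cong (λ n → slidesUpTo P n (boxOnes f̄) x) i↦1+c ⟨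
      slidesUpTo P (usedUpTo P f i) (boxOnes f̄) x                   ∎
      where
      i↦1+c : usedUpTo P f i ≡ suc c
      i↦1+c = trans (cong (c +_) (indicator-true i-used)) (+-comm c 1)
      c≥1 : 1 ≤ c
      c≥1 = ≤-trans (≤-reflexive (sym (indicator-true 1-used))) (usedUpTo-mono f (suc k) (s≤s z≤n))
      slides-suc : ∀ {n g} → 1 ≤ n → slidesUpTo P (suc n) g x ≡ slideStep P (suc n) (slidesUpTo P n g) x
      slides-suc {suc n} _ = refl
    by-usage false i-unused = begin
      usedUpTo P f (slideStep P i h x)              ≡⟨ cong (usedUpTo P f) (slide-absent i h absent x) ⟩
      usedUpTo P f (h x)                            ≡⟨ IH x ⟩
      slidesUpTo P c (boxOnes f̄) x                  ≡⟨ cong (λ n → slidesUpTo P n (boxOnes f̄) x) i↦c ⟨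
      slidesUpTo P (usedUpTo P f i) (boxOnes f̄) x   ∎
      where
      i↦c : usedUpTo P f i ≡ c
      i↦c = trans (cong (c +_) (indicator-false i-unused)) (+-identityʳ c)
      absent : ∀ y → h y ≢ i
      absent y e with slid-values (suc k) range y
      ... | inj₁ (box , _)      = 1+n≢0 (trans (sym e) box)
      ... | inj₂ (_ , z , fz≡v) = used-false⁻¹ f i-unused z (trans fz≡v e)

  deflate-pro-used : ∀ {q f} → InRange q f → used P f 1 ≡ true → deflate P (pro P q f) ≗ pro P (numUsed P q f) (deflate P f)
  deflate-pro-used {zero}  range _ x = ⊥-elim (<⇒≢ (≤-trans (proj₁ (range x)) (proj₂ (range x))) refl)
  deflate-pro-used {suc k} {f} range 1-used x with slid-values (suc k) range x
  ... | inj₁ (box , _) = begin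
    usedUpTo P (pro P q f) (fillBoxes q (slid q f x))    ≡⟨ cong (usedUpTo P (pro P q f)) (fillBoxes-box box) ⟩
    usedUpTo P (pro P q f) q                             ≡⟨ numUsed-pro range (s≤s z≤n) ⟩
    r                                                    ≡⟨ fillBoxes-box deflated-box ⟨
    fillBoxes r (slid r (deflate P f) x)                 ∎
    where
    open ≡-Reasoning
    q = suc k
    r = usedUpTo P f q
    deflated-box : slid r (deflate P f) x ≡ 0
    deflated-box = trans (sym (slides-deflate range 1-used k ≤-refl x)) (cong (usedUpTo P f) box)
  ... | inj₂ (2≤v , y , fy≡v) = begin
    usedUpTo P (pro P q f) (fillBoxes q v)                        ≡⟨ cong (usedUpTo P (pro P q f)) (fillBoxes-label 1≤v) ⟩
    usedUpTo P (pro P q f) (v ∸ 1)                                ≡⟨ m+n∸n≡m _ 1 ⟨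
    usedUpTo P (pro P q f) (v ∸ 1) + 1 ∸ 1                        ≡⟨ cong (λ z → usedUpTo P (pro P q f) (v ∸ 1) + z ∸ 1) (indicator-true 1-used) ⟨
    usedUpTo P (pro P q f) (v ∸ 1) + indicator P (used P f 1) ∸ 1 ≡⟨ cong (_∸ 1) (usedUpTo-pro range (v ∸ 1) v∸1<q) ⟩
    usedUpTo P f (suc (v ∸ 1)) ∸ 1                                ≡⟨ cong (λ z → usedUpTo P f z ∸ 1) (m+[n∸m]≡n 1≤v) ⟩
    usedUpTo P f v ∸ 1                                            ≡⟨ fillBoxes-label (usedUpTo-strict f 1≤v (used-true f fy≡v)) ⟨
    fillBoxes r (usedUpTo P f v)                                  ≡⟨ cong (fillBoxes r) (slides-deflate range 1-used k ≤-refl x) ⟩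
    fillBoxes r (slid r (deflate P f) x)                          ∎
    where
    open ≡-Reasoning
    q = suc k
    r = usedUpTo P f q
    v = slid q f x
    1≤v = ≤-trans (n≤1+n 1) 2≤v
    v∸1<q : v ∸ 1 < q
    v∸1<q = <-≤-trans (∸-monoʳ-< {o = 0} (s≤s z≤n) 1≤v) (subst (_≤ q) fy≡v (proj₂ (range y)))

  usedUpTo-∑ : ∀ g t → usedUpTo P g t ≡ ∑[ w < t ] indicator P (used P g (suc w))
  usedUpTo-∑ g zero    = refl
  usedUpTo-∑ g (suc t) = cong (_+ indicator P (used P g (suc t))) (usedUpTo-∑ g t)

  value-from-deflation : ∀ {m g} → InRange m g → ∀ x → g x ≡ ∑[ t < m ] 𝟙[ usedUpTo P g t < deflate P g x ]
  value-from-deflation {m} {g} range x = sym (trans (∑-cong m same-count) (∑-𝟙< m (proj₂ (range x))))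
    where
    same-count : ∀ t → 𝟙[ usedUpTo P g t < usedUpTo P g (g x) ] ≡ 𝟙[ t < g x ]
    same-count t with <-cmp t (g x)
    ... | tri< t<v _ _ = trans (𝟙<-yes (usedUpTo-strict g t<v (used-true g refl))) (sym (𝟙<-yes t<v))
    ... | tri≈ _ t≡v _ = trans (𝟙<-no (usedUpTo-mono g t (≤-reflexive (sym t≡v)))) (sym (𝟙<-no (≤-reflexive (sym t≡v))))
    ... | tri> _ _ v<t = trans (𝟙<-no (usedUpTo-mono g t (<⇒≤ v<t))) (sym (𝟙<-no (<⇒≤ v<t)))

-- The promotion orbit of f and its deflation

module Orbit (P : FinPoset) (q : ℕ) .{{_ : NonZero q}} (f : Labeling P) (range : InRange q f) where
  open Promotion P

  cyclicCon : ℕ → Bool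
  cyclicCon n = con P f (n % q)

  content : ℕ → ℕ
  content n = indicator P (cyclicCon n)

  r : ℕ
  r = numUsed P q f

  orbit : ℕ → Labeling P
  orbit k = proIter P q k f

  deflatedOrbit : ℕ → Labeling P
  deflatedOrbit j = proIter P r j (deflate P f)

  deflationSteps : ℕ → ℕ
  deflationSteps k = ∑< k content

  -- window k t = usedUpTo P (orbit k) t, by the invariant below.
  window : ℕ → ℕ → ℕ
  window k t = ∑[ w < t ] content (w + k)

  cyclicCon-periodic : ∀ n → cyclicCon (n + q) ≡ cyclicCon n
  cyclicCon-periodic n = cong (con P f) ([m+n]%n≡m%n n q)

  content-periodic : Periodic q content
  content-periodic n = cong (indicator P) (cyclicCon-periodic n)

  cyclicCon-below : ∀ {w} → w < q → cyclicCon w ≡ used P f (suc w)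
  cyclicCon-below {w} w<q = cong (λ v → used P f (suc v)) (m<n⇒m%n≡m w<q)

  ∑-content : ∑< q content ≡ r
  ∑-content = trans (∑-cong-< q (λ w w<q → cong (indicator P) (cyclicCon-below w<q))) (sym (usedUpTo-∑ f q))

  record Invariant (k : ℕ) : Set where
    field
      inRange  : InRange q (orbit k)
      rotated  : ∀ w → w < q → used P (orbit k) (suc w) ≡ cyclicCon (w + k)
      deflated : deflate P (orbit k) ≗ deflatedOrbit (deflationSteps k)

  numUsed-rotated : ∀ k {g} → (∀ w → w < q → used P g (suc w) ≡ cyclicCon (w + k)) → numUsed P q g ≡ r
  numUsed-rotated k {g} rot = begin
    usedUpTo P g q                                    ≡⟨ usedUpTo-∑ g q ⟩
    ∑[ w < q ] indicator P (used P g (suc w))         ≡⟨ ∑-cong-< q (λ w w<q → cong (indicator P) (rot w w<q)) ⟩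
    ∑[ w < q ] content (w + k)                        ≡⟨ ∑-rotate content-periodic k ⟩
    ∑< q content                                      ≡⟨ ∑-content ⟩
    r                                                 ∎
    where open ≡-Reasoning

  invariant : ∀ k → Invariant k
  invariant zero = record
    { inRange  = range
    ; rotated  = λ w w<q → trans (sym (cyclicCon-below w<q)) (cong cyclicCon (sym (+-identityʳ w)))
    ; deflated = λ x → refl
    }
  invariant (suc k) = record { inRange = pro-range inRange ; rotated = rotated′ ; deflated = deflated′ }
    where
    open Invariant (invariant k)
    open ≡-Reasoning
    rotated′ : ∀ w → w < q → used P (orbit (suc k)) (suc w) ≡ cyclicCon (w + suc k)
    rotated′ w w<q with suc w ≟ q
    ... | no 1+w≢q  = trans (used-pro inRange (s≤s z≤n) (≤∧≢⇒< w<q 1+w≢q))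
                            (trans (rotated (suc w) (≤∧≢⇒< w<q 1+w≢q)) (cong cyclicCon (sym (+-suc w k))))
    ... | yes 1+w≡q = begin
      used P (orbit (suc k)) (suc w)    ≡⟨ cong (used P (orbit (suc k))) 1+w≡q ⟩
      used P (orbit (suc k)) q          ≡⟨ used-pro-top inRange ⟩
      used P (orbit k) 1                ≡⟨ rotated 0 (>-nonZero⁻¹ q) ⟩
      cyclicCon k                       ≡⟨ cyclicCon-periodic k ⟨
      cyclicCon (k + q)                 ≡⟨ cong cyclicCon (trans (+-comm k q) (trans (cong (_+ k) (sym 1+w≡q)) (sym (+-suc w k)))) ⟩
      cyclicCon (w + suc k)             ∎
    deflated′ : deflate P (orbit (suc k)) ≗ deflatedOrbit (deflationSteps (suc k))
    deflated′ x = by-content (cyclicCon k) refl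
      where
      1-used≡ : used P (orbit k) 1 ≡ cyclicCon k
      1-used≡ = rotated 0 (>-nonZero⁻¹ q)
      advance : ∀ {b} → cyclicCon k ≡ b → deflationSteps (suc k) ≡ deflationSteps k + indicator P b
      advance ck = cong (λ b → deflationSteps k + indicator P b) ck
      by-content : ∀ b → cyclicCon k ≡ b → deflate P (orbit (suc k)) x ≡ deflatedOrbit (deflationSteps (suc k)) x
      by-content true ck = begin
        deflate P (pro P q (orbit k)) x                         ≡⟨ deflate-pro-used inRange (trans 1-used≡ ck) x ⟩
        pro P (numUsed P q (orbit k)) (deflate P (orbit k)) x   ≡⟨ cong (λ n → pro P n (deflate P (orbit k)) x) (numUsed-rotated k rotated) ⟩
        pro P r (deflate P (orbit k)) x                         ≡⟨ pro-cong r deflated x ⟩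
        deflatedOrbit (suc (deflationSteps k)) x                ≡⟨ cong (λ n → deflatedOrbit n x) (trans (+-comm 1 _) (sym (advance ck))) ⟩
        deflatedOrbit (deflationSteps (suc k)) x                ∎
      by-content false ck = begin
        deflate P (pro P q (orbit k)) x                         ≡⟨ deflate-pro-unused inRange (trans 1-used≡ ck) x ⟩
        deflate P (orbit k) x                                   ≡⟨ deflated x ⟩
        deflatedOrbit (deflationSteps k) x                      ≡⟨ cong (λ n → deflatedOrbit n x) (trans (sym (+-identityʳ _)) (sym (advance ck))) ⟩
        deflatedOrbit (deflationSteps (suc k)) x                ∎

  orbit-value : ∀ k x → orbit k x ≡ ∑[ t < q ] 𝟙[ window k t < deflatedOrbit (deflationSteps k) x ]
  orbit-value k x = trans (value-from-deflation inRange x) (∑-cong-< q (λ t t<q → cong₂ 𝟙[_<_] (usedUpTo≡window t t<q) (deflated x)))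
    where
    open Invariant (invariant k)
    usedUpTo≡window : ∀ t → t < q → usedUpTo P (orbit k) t ≡ window k t
    usedUpTo≡window t t<q = trans (usedUpTo-∑ (orbit k) t) (∑-cong-< t (λ w w<t → cong (indicator P) (rotated w (<-trans w<t t<q))))

-- Stable deflated orbits

module StableOrbit (P : FinPoset) (κ : Fin (FinPoset.size P) → Fin (FinPoset.size P)) (x : Fin (FinPoset.size P))
                   (r : ℕ) (h : Labeling P) (τ : ℕ) (orbit-range : ∀ s → InRange r (proIter P r s h))
                   (stable : IsXStable P κ x r h τ) where

  𝒪 : ℕ → Labeling P
  𝒪 s = proIter P r s h

  labelMultiplicity : ℕ → ℕ
  labelMultiplicity k = ∑[ s < τ ] (δ (𝒪 s x) k + δ (𝒪 s (κ x)) k)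

  above : ℕ → Labeling P → ℕ
  above c g = 𝟙[ c < g x ] + 𝟙[ c < g (κ x) ]

  countAbove : ℕ → ℕ
  countAbove c = ∑[ s < τ ] above c (𝒪 s)

  countEq≡δ : ∀ a b → countEq P a b ≡ δ a b
  countEq≡δ zero    zero    = refl
  countEq≡δ zero    (suc b) = refl
  countEq≡δ (suc a) zero    = refl
  countEq≡δ (suc a) (suc b) = countEq≡δ a b

  labelMultiplicity-symmetric : ∀ {k} → 1 ≤ k → k ≤ r → labelMultiplicity k ≡ labelMultiplicity (suc r ∸ k)
  labelMultiplicity-symmetric {k} 1≤k k≤r = trans (sym (antipodalMult≡ k)) (trans (stable k 1≤k k≤r) (antipodalMult≡ (suc r ∸ k)))
    where
    antipodalMult≡ : ∀ k → antipodalMult P κ x r h τ k ≡ labelMultiplicity k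
    antipodalMult≡ k = trans (sum-applyUpTo τ _) (∑-cong τ (λ s → cong₂ _+_ (countEq≡δ (𝒪 s x) k) (countEq≡δ (𝒪 s (κ x)) k)))

  ∑-δ-label : ∀ {v} → 1 ≤ v × v ≤ r → ∀ (G : ℕ → ℕ) → ∑[ k < r ] (δ v (suc k) * G (suc k)) ≡ G v
  ∑-δ-label {suc v} (_ , v<r) G = ∑-δ r (λ k → G (suc k)) v<r

  ∑-labelMultiplicity : ∑[ k < r ] labelMultiplicity (suc k) ≡ τ * 2
  ∑-labelMultiplicity = begin
    ∑[ k < r ] ∑[ s < τ ] (δ (𝒪 s x) (suc k) + δ (𝒪 s (κ x)) (suc k))    ≡⟨ ∑-swap r τ _ ⟩
    ∑[ s < τ ] ∑[ k < r ] (δ (𝒪 s x) (suc k) + δ (𝒪 s (κ x)) (suc k))    ≡⟨ ∑-cong τ two-labels ⟩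
    ∑[ s < τ ] 2                                                        ≡⟨ ∑-const τ 2 ⟩
    τ * 2                                                               ∎
    where
    open ≡-Reasoning
    once : ∀ v → 1 ≤ v × v ≤ r → ∑[ k < r ] δ v (suc k) ≡ 1
    once v v∈ = trans (∑-cong r (λ k → sym (*-identityʳ (δ v (suc k))))) (∑-δ-label v∈ (λ _ → 1))
    two-labels : ∀ s → ∑[ k < r ] (δ (𝒪 s x) (suc k) + δ (𝒪 s (κ x)) (suc k)) ≡ 2
    two-labels s = trans (∑-+ r _ _) (cong₂ _+_ (once (𝒪 s x) (orbit-range s x)) (once (𝒪 s (κ x)) (orbit-range s (κ x))))

  countAbove-by-label : ∀ c → countAbove c ≡ ∑[ k < r ] (labelMultiplicity (suc k) * 𝟙[ c < suc k ])
  countAbove-by-label c = begin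
    countAbove c
      ≡⟨ ∑-cong τ by-label ⟩
    ∑[ s < τ ] ∑[ k < r ] ((δ (𝒪 s x) (suc k) + δ (𝒪 s (κ x)) (suc k)) * 𝟙[ c < suc k ])
      ≡⟨ ∑-swap τ r _ ⟩
    ∑[ k < r ] ∑[ s < τ ] ((δ (𝒪 s x) (suc k) + δ (𝒪 s (κ x)) (suc k)) * 𝟙[ c < suc k ])
      ≡⟨ ∑-cong r (λ k → ∑-*ʳ τ 𝟙[ c < suc k ] _) ⟩
    ∑[ k < r ] (labelMultiplicity (suc k) * 𝟙[ c < suc k ])
      ∎
    where
    open ≡-Reasoning
    at : ∀ s y → 𝟙[ c < 𝒪 s y ] ≡ ∑[ k < r ] (δ (𝒪 s y) (suc k) * 𝟙[ c < suc k ])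
    at s y = sym (∑-δ-label (orbit-range s y) (λ k → 𝟙[ c < k ]))
    by-label : ∀ s → above c (𝒪 s) ≡ ∑[ k < r ] ((δ (𝒪 s x) (suc k) + δ (𝒪 s (κ x)) (suc k)) * 𝟙[ c < suc k ])
    by-label s = trans (cong₂ _+_ (at s x) (at s (κ x)))
                       (trans (sym (∑-+ r _ _)) (∑-cong r (λ k → sym (*-distribʳ-+ 𝟙[ c < suc k ] (δ (𝒪 s x) (suc k)) _))))

  𝟙<-complement : ∀ {c c′ k} → c + c′ ≡ r → k < r → 𝟙[ c < suc k ] + 𝟙[ c′ < r ∸ k ] ≡ 1
  𝟙<-complement {c} {c′} {k} c+c′≡r k<r with c ≤? k
  ... | yes c≤k = cong₂ _+_ (𝟙<-yes (s≤s c≤k)) (𝟙<-no (subst (r ∸ k ≤_) r∸c≡c′ (∸-monoʳ-≤ r c≤k)))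
    where r∸c≡c′ = trans (cong (_∸ c) (sym c+c′≡r)) (m+n∸m≡n c c′)
  ... | no c≰k = cong₂ _+_ (𝟙<-no (≰⇒> c≰k))
                          (𝟙<-yes (subst (_< r ∸ k) r∸c≡c′ (∸-monoʳ-< (≰⇒> c≰k) (subst (c ≤_) c+c′≡r (m≤m+n c c′)))))
    where r∸c≡c′ = trans (cong (_∸ c) (sym c+c′≡r)) (m+n∸m≡n c c′)

  -- x-stability makes the multiplicities symmetric under k ↦ r + 1 − k, which turns the
  -- counts above c and above r − c into complementary counts.
  countAbove-complement : ∀ {c c′} → c + c′ ≡ r → countAbove c + countAbove c′ ≡ τ * 2
  countAbove-complement {c} {c′} c+c′≡r = begin
    countAbove c + countAbove c′
      ≡⟨ cong₂ _+_ (countAbove-by-label c) (trans (countAbove-by-label c′) (∑-reverse r _)) ⟩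
    ∑[ k < r ] (M (suc k) * 𝟙[ c < suc k ]) + ∑[ k < r ] (M (suc (r ∸ suc k)) * 𝟙[ c′ < suc (r ∸ suc k) ])
      ≡⟨ cong (∑[ k < r ] (M (suc k) * 𝟙[ c < suc k ]) +_) (∑-cong-< r reflected) ⟩
    ∑[ k < r ] (M (suc k) * 𝟙[ c < suc k ]) + ∑[ k < r ] (M (suc k) * 𝟙[ c′ < r ∸ k ])
      ≡⟨ ∑-+ r _ _ ⟨
    ∑[ k < r ] (M (suc k) * 𝟙[ c < suc k ] + M (suc k) * 𝟙[ c′ < r ∸ k ])
      ≡⟨ ∑-cong-< r complementary ⟩
    ∑[ k < r ] M (suc k)
      ≡⟨ ∑-labelMultiplicity ⟩
    τ * 2
      ∎
    where
    open ≡-Reasoning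
    M = labelMultiplicity
    complementary : ∀ k → k < r → M (suc k) * 𝟙[ c < suc k ] + M (suc k) * 𝟙[ c′ < r ∸ k ] ≡ M (suc k)
    complementary k k<r = begin
      M (suc k) * 𝟙[ c < suc k ] + M (suc k) * 𝟙[ c′ < r ∸ k ] ≡⟨ *-distribˡ-+ (M (suc k)) _ _ ⟨
      M (suc k) * (𝟙[ c < suc k ] + 𝟙[ c′ < r ∸ k ])           ≡⟨ cong (M (suc k) *_) (𝟙<-complement {c} {c′} c+c′≡r k<r) ⟩
      M (suc k) * 1                                            ≡⟨ *-identityʳ (M (suc k)) ⟩
      M (suc k)                                                ∎
    reflected : ∀ k → k < r → M (suc (r ∸ suc k)) * 𝟙[ c′ < suc (r ∸ suc k) ] ≡ M (suc k) * 𝟙[ c′ < r ∸ k ]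
    reflected k k<r = begin
      M (suc (r ∸ suc k)) * 𝟙[ c′ < suc (r ∸ suc k) ]   ≡⟨ cong (λ n → M n * 𝟙[ c′ < n ]) (+-∸-assoc 1 k<r) ⟨
      M (r ∸ k) * 𝟙[ c′ < r ∸ k ]                       ≡⟨ cong (_* 𝟙[ c′ < r ∸ k ]) (labelMultiplicity-symmetric 1≤r∸k (m∸n≤m r k)) ⟩
      M (suc r ∸ (r ∸ k)) * 𝟙[ c′ < r ∸ k ]             ≡⟨ cong (λ n → M n * 𝟙[ c′ < r ∸ k ]) r+1∸[r∸k]≡1+k ⟩
      M (suc k) * 𝟙[ c′ < r ∸ k ]                       ∎
      where
      1≤r∸k = subst (1 ≤_) (sym (+-∸-assoc 1 k<r)) (s≤s z≤n)
      r+1∸[r∸k]≡1+k = trans (+-∸-assoc 1 (m∸n≤m r k)) (cong suc (m∸[m∸n]≡n (<⇒≤ k<r)))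

  countAbove-top : countAbove r ≡ 0
  countAbove-top = trans (∑-cong τ (λ s → cong₂ _+_ (𝟙<-no (proj₂ (orbit-range s x))) (𝟙<-no (proj₂ (orbit-range s (κ x)))))) (∑-zero τ)

-- The orbit average of the antipodal sum

module AntipodalOrbitSum (P : FinPoset) (q : ℕ) .{{_ : NonZero q}} (f : Labeling P) (range : InRange q f)
  (κ : Fin (FinPoset.size P) → Fin (FinPoset.size P)) (x : Fin (FinPoset.size P))
  (ℓ τ : ℕ) (ℓ≥1 : 1 ≤ ℓ) (τ≥1 : 1 ≤ τ)
  (con-period : ∀ j → j < q → con P f ((j + ℓ) % q) ≡ con P f j)
  (deflation-period : proIter P (numUsed P q f) τ (deflate P f) ≗ deflate P f)
  (coprime : gcd (numUsed P q f * ℓ / q) τ ≡ 1)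
  (stable : IsXStable P κ x (numUsed P q f) (deflate P f) τ) where

  open Promotion P
  open Orbit P q f range

  deflatedOrbit-range : ∀ s → InRange r (deflatedOrbit s)
  deflatedOrbit-range zero    y = usedUpTo-strict f (proj₁ (range y)) (used-true f refl) , usedUpTo-mono f q (proj₂ (range y))
  deflatedOrbit-range (suc s) = pro-range (deflatedOrbit-range s)

  open StableOrbit P κ x r (deflate P f) τ deflatedOrbit-range stable

  instance
    τ-nonZero : NonZero τ
    τ-nonZero = >-nonZero τ≥1

  content-periodic-ℓ : Periodic ℓ content
  content-periodic-ℓ n = cong (indicator P) (begin
    con P f ((n + ℓ) % q)                   ≡⟨ cong (con P f) (%-distribˡ-+ n ℓ q) ⟩
    con P f ((n % q + ℓ % q) % q)           ≡⟨ cong (λ z → con P f ((z + ℓ % q) % q)) (m%n%n≡m%n n q) ⟨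
    con P f ((n % q % q + ℓ % q) % q)       ≡⟨ cong (con P f) (%-distribˡ-+ (n % q) ℓ q) ⟨
    con P f ((n % q + ℓ) % q)               ≡⟨ con-period (n % q) (m%n<n n q) ⟩
    con P f (n % q)                         ∎)
    where open ≡-Reasoning

  stepsPerPeriod : ℕ
  stepsPerPeriod = ∑< ℓ content

  stepsPerPeriod≡ : r * ℓ / q ≡ stepsPerPeriod
  stepsPerPeriod≡ = trans (cong (_/ q) r*ℓ≡) (m*n/n≡m stepsPerPeriod q)
    where
    r*ℓ≡ : r * ℓ ≡ stepsPerPeriod * q
    r*ℓ≡ = begin
      r * ℓ                      ≡⟨ *-comm r ℓ ⟩
      ℓ * r                      ≡⟨ cong (ℓ *_) ∑-content ⟨
      ℓ * ∑< q content           ≡⟨ ∑-two-periods content-periodic content-periodic-ℓ ⟩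
      q * stepsPerPeriod         ≡⟨ *-comm q stepsPerPeriod ⟩
      stepsPerPeriod * q         ∎
      where open ≡-Reasoning

  coprime-steps : Coprime τ stepsPerPeriod
  coprime-steps = Coprimality.sym (gcd≡1⇒coprime (subst (λ z → gcd z τ ≡ 1) stepsPerPeriod≡ coprime))

  deflatedOrbit-periodic : ∀ y → Periodic τ (λ j → deflatedOrbit j y)
  deflatedOrbit-periodic y j = trans (proIter-+ r j τ (deflate P f) y) (proIter-cong r j deflation-period y)

  deflationSteps-blocks : ∀ m a → deflationSteps (m * ℓ + a) ≡ m * stepsPerPeriod + deflationSteps a
  deflationSteps-blocks m a = trans (∑-split (m * ℓ) a content)
    (cong₂ _+_ (∑-periodic-* content-periodic-ℓ m)
               (∑-cong a (λ k → trans (cong content (+-comm (m * ℓ) k)) (periodic-+* content-periodic-ℓ m k))))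

  window-periodic : ∀ t → Periodic ℓ (λ a → window a t)
  window-periodic t a = ∑-cong t (λ w → trans (cong content (sym (+-assoc w a ℓ))) (content-periodic-ℓ (w + a)))

  window-blocks : ∀ m a t → window (m * ℓ + a) t ≡ window a t
  window-blocks m a t = trans (cong (λ k → window k t) (+-comm (m * ℓ) a)) (periodic-+* (window-periodic t) m a)

  window-full : ∀ a → window a q ≡ r
  window-full a = trans (∑-rotate content-periodic a) ∑-content

  window-complement : ∀ a {t} → t ≤ q → window a t + window (a + t) (q ∸ t) ≡ r
  window-complement a {t} t≤q = begin
    window a t + window (a + t) (q ∸ t)
      ≡⟨ cong (window a t +_) (∑-cong (q ∸ t) (λ w → cong content (shift w))) ⟩
    window a t + ∑[ w < q ∸ t ] content (t + w + a)
      ≡⟨ ∑-split t (q ∸ t) (λ w → content (w + a)) ⟨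
    ∑[ w < t + (q ∸ t) ] content (w + a)
      ≡⟨ cong (λ n → ∑[ w < n ] content (w + a)) (m+[n∸m]≡n t≤q) ⟩
    window a q
      ≡⟨ window-full a ⟩
    r
      ∎
    where
    open ≡-Reasoning
    shift : ∀ w → w + (a + t) ≡ t + w + a
    shift w = trans (cong (w +_) (+-comm a t)) (trans (sym (+-assoc w t a)) (cong (_+ a) (+-comm w t)))

  𝒜 : ℕ → ℕ
  𝒜 k = antipodalSum P κ x (orbit k)

  𝒜-by-windows : ∀ k → 𝒜 k ≡ ∑[ t < q ] above (window k t) (deflatedOrbit (deflationSteps k))
  𝒜-by-windows k = trans (cong₂ _+_ (orbit-value k x) (orbit-value k (κ x))) (sym (∑-+ q _ _))

  ∑-𝒜-by-windows : ∑< (τ * ℓ) 𝒜 ≡ ∑[ a < ℓ ] ∑[ t < q ] countAbove (window a t)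
  ∑-𝒜-by-windows = begin
    ∑< (τ * ℓ) 𝒜
      ≡⟨ ∑-blocks τ ℓ 𝒜 ⟩
    ∑[ m < τ ] ∑[ a < ℓ ] 𝒜 (m * ℓ + a)
      ≡⟨ ∑-cong τ (λ m → ∑-cong ℓ (block m)) ⟩
    ∑[ m < τ ] ∑[ a < ℓ ] ∑[ t < q ] above (window a t) (deflatedOrbit (deflationSteps a + m * stepsPerPeriod))
      ≡⟨ ∑-swap τ ℓ _ ⟩
    ∑[ a < ℓ ] ∑[ m < τ ] ∑[ t < q ] above (window a t) (deflatedOrbit (deflationSteps a + m * stepsPerPeriod))
      ≡⟨ ∑-cong ℓ (λ a → ∑-swap τ q _) ⟩
    ∑[ a < ℓ ] ∑[ t < q ] ∑[ m < τ ] above (window a t) (deflatedOrbit (deflationSteps a + m * stepsPerPeriod))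
      ≡⟨ ∑-cong ℓ (λ a → ∑-cong q (λ t → ∑-coprime-step τ (deflationSteps a) (above-periodic (window a t)) coprime-steps)) ⟩
    ∑[ a < ℓ ] ∑[ t < q ] countAbove (window a t)
      ∎
    where
    open ≡-Reasoning
    steps : ∀ m a → deflationSteps (m * ℓ + a) ≡ deflationSteps a + m * stepsPerPeriod
    steps m a = trans (deflationSteps-blocks m a) (+-comm (m * stepsPerPeriod) (deflationSteps a))
    block : ∀ m a → 𝒜 (m * ℓ + a) ≡ ∑[ t < q ] above (window a t) (deflatedOrbit (deflationSteps a + m * stepsPerPeriod))
    block m a = trans (𝒜-by-windows (m * ℓ + a)) (∑-cong q (λ t → cong₂ above (window-blocks m a t) (cong deflatedOrbit (steps m a))))
    above-periodic : ∀ c → Periodic τ (λ j → above c (deflatedOrbit j))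
    above-periodic c j = cong₂ _+_ (cong 𝟙[ c <_] (deflatedOrbit-periodic x j)) (cong 𝟙[ c <_] (deflatedOrbit-periodic (κ x) j))

  aboveWindows : ℕ → ℕ
  aboveWindows t = ∑[ a < ℓ ] countAbove (window a t)

  aboveWindows-reflect : ∀ {t} → t ≤ q → aboveWindows t + aboveWindows (q ∸ t) ≡ ℓ * (τ * 2)
  aboveWindows-reflect {t} t≤q = begin
    aboveWindows t + aboveWindows (q ∸ t)
      ≡⟨ cong (aboveWindows t +_) (∑-rotate (λ a → cong countAbove (window-periodic (q ∸ t) a)) t) ⟨
    aboveWindows t + ∑[ a < ℓ ] countAbove (window (a + t) (q ∸ t))
      ≡⟨ ∑-+ ℓ _ _ ⟨
    ∑[ a < ℓ ] (countAbove (window a t) + countAbove (window (a + t) (q ∸ t)))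
      ≡⟨ ∑-cong ℓ (λ a → countAbove-complement {window a t} {window (a + t) (q ∸ t)} (window-complement a t≤q)) ⟩
    ∑[ a < ℓ ] (τ * 2)
      ≡⟨ ∑-const ℓ (τ * 2) ⟩
    ℓ * (τ * 2)
      ∎
    where open ≡-Reasoning

  ∑-aboveWindows : ∑< q aboveWindows ≡ suc q * (ℓ * τ)
  ∑-aboveWindows = begin
    ∑< q aboveWindows                        ≡⟨ +-identityʳ _ ⟨
    ∑< q aboveWindows + 0                    ≡⟨ cong (∑< q aboveWindows +_) top ⟨
    ∑< (suc q) aboveWindows                  ≡⟨ *-cancelˡ-≡ _ _ 2 doubled ⟩
    suc q * (ℓ * τ)                          ∎
    where
    open ≡-Reasoning
    top : aboveWindows q ≡ 0
    top = trans (∑-cong ℓ (λ a → trans (cong countAbove (window-full a)) countAbove-top)) (∑-zero ℓ)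
    doubled : 2 * ∑< (suc q) aboveWindows ≡ 2 * (suc q * (ℓ * τ))
    doubled = begin
      2 * ∑< (suc q) aboveWindows
        ≡⟨ cong (∑< (suc q) aboveWindows +_) (+-identityʳ _) ⟩
      ∑< (suc q) aboveWindows + ∑< (suc q) aboveWindows
        ≡⟨ cong (∑< (suc q) aboveWindows +_) (∑-reverse (suc q) aboveWindows) ⟩
      ∑< (suc q) aboveWindows + ∑[ t < suc q ] aboveWindows (q ∸ t)
        ≡⟨ ∑-+ (suc q) _ _ ⟨
      ∑[ t < suc q ] (aboveWindows t + aboveWindows (q ∸ t))
        ≡⟨ ∑-cong-< (suc q) (λ t t<1+q → aboveWindows-reflect (≤-pred t<1+q)) ⟩
      ∑[ t < suc q ] (ℓ * (τ * 2))
        ≡⟨ ∑-const (suc q) _ ⟩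
      suc q * (ℓ * (τ * 2))
        ≡⟨ solve 4 (λ s l t two → s :* (l :* (t :* two)) := two :* (s :* (l :* t))) refl (suc q) ℓ τ 2 ⟩
      2 * (suc q * (ℓ * τ))
        ∎
      where open +-*-Solver

  ∑-𝒜-full-period : ∑< (τ * ℓ) 𝒜 ≡ suc q * (ℓ * τ)
  ∑-𝒜-full-period = trans ∑-𝒜-by-windows (trans (∑-swap ℓ q _) ∑-aboveWindows)

  orbit-full-period : orbit (τ * ℓ) ≗ f
  orbit-full-period y = begin
    orbit (τ * ℓ) y
      ≡⟨ cong (λ k → orbit k y) (+-identityʳ (τ * ℓ)) ⟨
    orbit (τ * ℓ + 0) y
      ≡⟨ orbit-value (τ * ℓ + 0) y ⟩
    ∑[ t < q ] 𝟙[ window (τ * ℓ + 0) t < deflatedOrbit (deflationSteps (τ * ℓ + 0)) y ]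
      ≡⟨ ∑-cong q (λ t → cong₂ 𝟙[_<_] (window-blocks τ 0 t) back-to-start) ⟩
    ∑[ t < q ] 𝟙[ window 0 t < deflatedOrbit 0 y ]
      ≡⟨ orbit-value 0 y ⟨
    f y
      ∎
    where
    open ≡-Reasoning
    back-to-start : deflatedOrbit (deflationSteps (τ * ℓ + 0)) y ≡ deflatedOrbit 0 y
    back-to-start = trans (cong (λ j → deflatedOrbit j y) (trans (deflationSteps-blocks τ 0) (trans (+-identityʳ _) (*-comm τ stepsPerPeriod))))
                          (periodic-+* (deflatedOrbit-periodic y) stepsPerPeriod 0)

  𝒜-periodic : ∀ p → orbit p ≗ f → Periodic p 𝒜
  𝒜-periodic p period k = cong₂ _+_ (returns x) (returns (κ x))
    where
    returns : ∀ y → orbit (k + p) y ≡ orbit k y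
    returns y = trans (proIter-+ q k p f y) (proIter-cong q k period y)

  ∑-𝒜-orbit : ∀ σ → orbit σ ≗ f → ∑< σ 𝒜 ≡ σ * suc q
  ∑-𝒜-orbit σ period = *-cancelˡ-≡ _ _ (τ * ℓ) {{>-nonZero (*-mono-≤ τ≥1 ℓ≥1)}} (begin
    τ * ℓ * ∑< σ 𝒜                ≡⟨ ∑-two-periods (𝒜-periodic σ period) (𝒜-periodic (τ * ℓ) orbit-full-period) ⟩
    σ * ∑< (τ * ℓ) 𝒜              ≡⟨ cong (σ *_) ∑-𝒜-full-period ⟩
    σ * (suc q * (ℓ * τ))         ≡⟨ solve 4 (λ s q′ l t → s :* (q′ :* (l :* t)) := t :* l :* (s :* q′)) refl σ (suc q) ℓ τ ⟩
    τ * ℓ * (σ * suc q)           ∎)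
    where
    open ≡-Reasoning
    open +-*-Solver

-- The average over Inc^q(P)

∑∈ : List A → (A → ℕ) → ℕ
∑∈ L F = sum (map F L)

syntax ∑∈ L (λ a → e) = ∑[ a ∈ L ] e


∑∈-cong-local : ∀ {L : List A} {F G : A → ℕ} → All (λ a → F a ≡ G a) L → ∑∈ L F ≡ ∑∈ L G
∑∈-cong-local eqs = cong sum (map-cong-local eqs)

∑∈-cong : ∀ (L : List A) {F G : A → ℕ} → (∀ a → F a ≡ G a) → ∑∈ L F ≡ ∑∈ L G
∑∈-cong L eq = cong sum (map-cong eq L)

∑∈-+ : ∀ (L : List A) F G → ∑[ a ∈ L ] (F a + G a) ≡ ∑∈ L F + ∑∈ L G
∑∈-+ []      F G = refl
∑∈-+ (a ∷ L) F G rewrite ∑∈-+ L F G = interchange (F a) (G a) (∑∈ L F) (∑∈ L G)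

∑∈-*ˡ : ∀ (L : List A) c F → ∑[ a ∈ L ] (c * F a) ≡ c * ∑∈ L F
∑∈-*ˡ []      c F = sym (*-zeroʳ c)
∑∈-*ˡ (a ∷ L) c F = trans (cong (c * F a +_) (∑∈-*ˡ L c F)) (sym (*-distribˡ-+ c (F a) (∑∈ L F)))

∑∈-*ʳ : ∀ (L : List A) c F → ∑[ a ∈ L ] (F a * c) ≡ ∑∈ L F * c
∑∈-*ʳ L c F = trans (∑∈-cong L (λ a → *-comm (F a) c)) (trans (∑∈-*ˡ L c F) (*-comm c (∑∈ L F)))

∑∈-const : ∀ (L : List A) c → ∑[ _ ∈ L ] c ≡ length L * c
∑∈-const []      c = refl
∑∈-const (a ∷ L) c = cong (c +_) (∑∈-const L c)

∑∈-swap : (L : List A) (K : List B) (F : A → B → ℕ) →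
          ∑[ a ∈ L ] ∑[ b ∈ K ] F a b ≡ ∑[ b ∈ K ] ∑[ a ∈ L ] F a b
∑∈-swap []      K F = sym (trans (∑∈-const K 0) (*-zeroʳ (length K)))
∑∈-swap (a ∷ L) K F = trans (cong (∑∈ K (F a) +_) (∑∈-swap L K F)) (sym (∑∈-+ K (F a) (λ b → ∑[ a ∈ L ] F a b)))

∑∈-filterᵇ : ∀ (p : A → Bool) L F → ∑∈ (filterᵇ p L) F ≡ ∑[ a ∈ L ] (if p a then F a else 0)
∑∈-filterᵇ p []      F = refl
∑∈-filterᵇ p (a ∷ L) F with p a
... | true  = cong (F a +_) (∑∈-filterᵇ p L F)
... | false = ∑∈-filterᵇ p L F

∑∈-++ : ∀ (L K : List A) F → ∑∈ (L ++ K) F ≡ ∑∈ L F + ∑∈ K F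
∑∈-++ []      K F = refl
∑∈-++ (a ∷ L) K F = trans (cong (F a +_) (∑∈-++ L K F)) (sym (+-assoc (F a) (∑∈ L F) (∑∈ K F)))

∑∈-concatMap : ∀ (h : B → List A) L F → ∑∈ (concatMap h L) F ≡ ∑[ b ∈ L ] ∑∈ (h b) F
∑∈-concatMap h []      F = refl
∑∈-concatMap h (b ∷ L) F = trans (∑∈-++ (h b) (concatMap h L) F) (cong (∑∈ (h b) F +_) (∑∈-concatMap h L F))

∑∈-map : ∀ (h : B → A) L F → ∑∈ (map h L) F ≡ ∑[ b ∈ L ] F (h b)
∑∈-map h []      F = refl
∑∈-map h (b ∷ L) F = cong (F (h b) +_) (∑∈-map h L F)

∑∈-applyUpTo : ∀ (h : ℕ → A) n F → ∑∈ (applyUpTo h n) F ≡ ∑[ k < n ] F (h k)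
∑∈-applyUpTo h zero    F = refl
∑∈-applyUpTo h (suc n) F = trans (cong (F (h 0) +_) (∑∈-applyUpTo (λ k → h (suc k)) n F)) (sym (∑-head n (λ k → F (h k))))

𝟙[_≗_] : ∀ {n} → (Fin n → ℕ) → (Fin n → ℕ) → ℕ
𝟙[_≗_] {zero}  f g = 1
𝟙[_≗_] {suc n} f g = δ (f zero) (g zero) * 𝟙[ (λ i → f (suc i)) ≗ (λ i → g (suc i)) ]

𝟙≗-cases : ∀ {n} (f g : Fin n → ℕ) → (f ≗ g × 𝟙[ f ≗ g ] ≡ 1) ⊎ (¬ f ≗ g × 𝟙[ f ≗ g ] ≡ 0)
𝟙≗-cases {zero}  f g = inj₁ ((λ ()) , refl)
𝟙≗-cases {suc n} f g with f zero ≟ g zero | 𝟙≗-cases (λ i → f (suc i)) (λ i → g (suc i))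
... | no ne | _                = inj₂ ((λ eq → ne (eq zero)) , cong (_* 𝟙[ (λ i → f (suc i)) ≗ (λ i → g (suc i)) ]) (δ-≢ ne))
... | yes e | inj₁ (eq , one)  = inj₁ ((λ { zero → e ; (suc i) → eq i }) , cong₂ _*_ (δ-≡ e) one)
... | yes e | inj₂ (ne , none) = inj₂ ((λ eq → ne (λ i → eq (suc i))) , trans (cong (δ (f zero) (g zero) *_) none) (*-zeroʳ (δ (f zero) (g zero))))

𝟙≗-no : ∀ {n} {f g : Fin n → ℕ} → ¬ f ≗ g → 𝟙[ f ≗ g ] ≡ 0
𝟙≗-no {f = f} {g} ne with 𝟙≗-cases f g
... | inj₁ (eq , _)   = ⊥-elim (ne eq)
... | inj₂ (_ , none) = none

𝟙≗-⇔ : ∀ {n} {f g f′ g′ : Fin n → ℕ} → (f ≗ g → f′ ≗ g′) → (f′ ≗ g′ → f ≗ g) → 𝟙[ f ≗ g ] ≡ 𝟙[ f′ ≗ g′ ]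
𝟙≗-⇔ {f = f} {g} {f′} {g′} to from with 𝟙≗-cases f g | 𝟙≗-cases f′ g′
... | inj₁ (_ , one)   | inj₁ (_ , one′)   = trans one (sym one′)
... | inj₁ (eq , _)    | inj₂ (ne′ , _)    = ⊥-elim (ne′ (to eq))
... | inj₂ (ne , _)    | inj₁ (eq′ , _)    = ⊥-elim (ne (from eq′))
... | inj₂ (_ , none)  | inj₂ (_ , none′)  = trans none (sym none′)

-- Labellings are functions, so they are counted up to pointwise equality.
multiplicity : ∀ {n} → List (Fin n → ℕ) → (Fin n → ℕ) → ℕ
multiplicity L g = ∑[ f ∈ L ] 𝟙[ f ≗ g ]

multiplicity-allLabelingsFin : ∀ n q {g : Fin n → ℕ} → InRange q g → multiplicity (allLabelingsFin n q) g ≡ 1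
multiplicity-allLabelingsFin zero    q rg = refl
multiplicity-allLabelingsFin (suc n) q {g} rg =
  trans (∑∈-concatMap _ (applyUpTo suc q) _)
  (trans (∑∈-applyUpTo suc q _)
  (trans (∑-cong q (λ k → trans (∑∈-map _ (allLabelingsFin n q) _)
                           (trans (∑∈-*ˡ (allLabelingsFin n q) (δ (suc k) (g zero)) _)
                                  (cong (δ (suc k) (g zero) *_) (multiplicity-allLabelingsFin n q (λ y → rg (suc y)))))))
  (first-coordinate (g zero) (rg zero))))
  where
  first-coordinate : ∀ v → 1 ≤ v × v ≤ q → ∑[ k < q ] (δ (suc k) v * 1) ≡ 1
  first-coordinate (suc v) (_ , v<q) = trans (∑-cong q (λ k → trans (*-identityʳ _) (δ-sym k v))) (∑-δ-one q v<q)

Enumerates : ∀ {n} → List (Fin n → ℕ) → ((Fin n → ℕ) → Set) → Set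
Enumerates L Good = All Good L × (∀ {g} → Good g → multiplicity L g ≡ 1)

∑∈-𝟙≗-weighted : ∀ {n} (L : List (Fin n → ℕ)) {H} → H Preserves _≗_ ⟶ _≡_ →
                 ∀ u → ∑[ g ∈ L ] (𝟙[ g ≗ u ] * H g) ≡ multiplicity L u * H u
∑∈-𝟙≗-weighted L {H} H-resp u = trans (∑∈-cong L term) (∑∈-*ʳ L (H u) (λ g → 𝟙[ g ≗ u ]))
  where
  term : ∀ g → 𝟙[ g ≗ u ] * H g ≡ 𝟙[ g ≗ u ] * H u
  term g with 𝟙≗-cases g u
  ... | inj₁ (eq , _)   = cong (𝟙[ g ≗ u ] *_) (H-resp eq)
  ... | inj₂ (_ , none) = trans (cong (_* H g) none) (sym (cong (_* H u) none))

∑∈-involution : ∀ {n} {L : List (Fin n → ℕ)} {Good} → Enumerates L Good →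
                ∀ (φ : (Fin n → ℕ) → (Fin n → ℕ)) → (∀ {f} → Good f → Good (φ f)) →
                (∀ {f} → Good f → φ (φ f) ≗ f) → φ Preserves _≗_ ⟶ _≗_ →
                ∀ {H} → H Preserves _≗_ ⟶ _≡_ → ∑[ f ∈ L ] H (φ f) ≡ ∑∈ L H
∑∈-involution {L = L} {Good} (good , once) φ φ-good φ-inv φ-resp {H} H-resp = begin
  ∑[ f ∈ L ] H (φ f)                            ≡⟨ ∑∈-cong-local (All.map (λ gf → sym (collapse gf)) good) ⟩
  ∑[ f ∈ L ] ∑[ g ∈ L ] (𝟙[ g ≗ φ f ] * H g)    ≡⟨ ∑∈-swap L L (λ f g → 𝟙[ g ≗ φ f ] * H g) ⟩
  ∑[ g ∈ L ] ∑[ f ∈ L ] (𝟙[ g ≗ φ f ] * H g)    ≡⟨ ∑∈-cong L (λ g → ∑∈-*ʳ L (H g) (λ f → 𝟙[ g ≗ φ f ])) ⟩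
  ∑[ g ∈ L ] (∑[ f ∈ L ] 𝟙[ g ≗ φ f ] * H g)    ≡⟨ ∑∈-cong-local (All.map (λ gg → cong (_* _) (∑∈-cong-local (All.map (swap gg) good))) good) ⟩
  ∑[ g ∈ L ] (multiplicity L (φ g) * H g)       ≡⟨ ∑∈-cong-local (All.map (λ gg → trans (cong (_* _) (once (φ-good gg))) (*-identityˡ _)) good) ⟩
  ∑∈ L H                                        ∎
  where
  open ≡-Reasoning
  collapse : ∀ {f} → Good f → ∑[ g ∈ L ] (𝟙[ g ≗ φ f ] * H g) ≡ H (φ f)
  collapse {f} gf = trans (∑∈-𝟙≗-weighted L H-resp (φ f)) (trans (cong (_* H (φ f)) (once (φ-good gf))) (*-identityˡ (H (φ f))))
  swap : ∀ {g f} → Good g → Good f → 𝟙[ g ≗ φ f ] ≡ 𝟙[ f ≗ φ g ]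
  swap gg gf = 𝟙≗-⇔ (λ eq y → trans (sym (φ-inv gf y)) (φ-resp (λ z → sym (eq z)) y))
                    (λ eq y → trans (sym (φ-inv gg y)) (φ-resp (λ z → sym (eq z)) y))

module _ (P : FinPoset) (q : ℕ) where
  open FinPoset P

  IsInc-resp : ∀ {f g} → f ≗ g → IsInc P q f → IsInc P q g
  IsInc-resp eq (range , increasing) =
    (λ y → subst (λ v → 1 ≤ v × v ≤ q) (eq y) (range y)) , (λ a b a≺b → subst₂ _<_ (eq a) (eq b) (increasing a b a≺b))

  incList-enumerates : Enumerates (incList P q) (IsInc P q)
  incList-enumerates = All.map toWitness (all-filter (λ f → T? ⌊ isInc? P q f ⌋) (allLabelingsFin size q)) , once
    where
    once : ∀ {g} → IsInc P q g → multiplicity (incList P q) g ≡ 1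
    once {g} ig = begin
      multiplicity (incList P q) g                                                 ≡⟨ ∑∈-filterᵇ _ (allLabelingsFin size q) (λ f → 𝟙[ f ≗ g ]) ⟩
      ∑[ f ∈ allLabelingsFin size q ] (if ⌊ isInc? P q f ⌋ then 𝟙[ f ≗ g ] else 0) ≡⟨ ∑∈-cong (allLabelingsFin size q) filtered-term ⟩
      multiplicity (allLabelingsFin size q) g                                      ≡⟨ multiplicity-allLabelingsFin size q (proj₁ ig) ⟩
      1                                                                            ∎
      where
      open ≡-Reasoning
      filtered-term : ∀ f → (if ⌊ isInc? P q f ⌋ then 𝟙[ f ≗ g ] else 0) ≡ 𝟙[ f ≗ g ]
      filtered-term f = if-⌊⌋-else-0 (isInc? P q f) (λ ¬inc → 𝟙≗-no (λ eq → ¬inc (IsInc-resp (λ y → sym (eq y)) ig)))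

module Duality (P : FinPoset) (D : SelfDual P) (q : ℕ) where
  open FinPoset P
  open SelfDual D

  dual : Labeling P → Labeling P
  dual f y = suc q ∸ f (κ y)

  κ-injective : ∀ {a b} → κ a ≡ κ b → a ≡ b
  κ-injective {a} {b} e = trans (sym (involutive a)) (trans (cong κ e) (involutive b))

  dual-isInc : ∀ {f} → IsInc P q f → IsInc P q (dual f)
  dual-isInc {f} (range , increasing) = range′ , increasing′
    where
    range′ : ∀ y → 1 ≤ dual f y × dual f y ≤ q
    range′ y = subst (_≤ dual f y) (m+n∸n≡m 1 q) (∸-monoʳ-≤ (suc q) (proj₂ (range (κ y)))) , ∸-monoʳ-≤ (suc q) (proj₁ (range (κ y)))
    increasing′ : ∀ a b → a ≺ b → dual f a < dual f b
    increasing′ a b (a≼b , a≢b) =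
      ∸-monoʳ-< (increasing (κ b) (κ a) (reversing a b a≼b , λ e → a≢b (sym (κ-injective e)))) (m≤n⇒m≤1+n (proj₂ (range (κ a))))

  dual-involutive : ∀ {f} → InRange q f → dual (dual f) ≗ f
  dual-involutive {f} range y = trans (m∸[m∸n]≡n (m≤n⇒m≤1+n (proj₂ (range (κ (κ y)))))) (cong f (involutive y))

  dual-resp : dual Preserves _≗_ ⟶ _≗_
  dual-resp eq y = cong (suc q ∸_) (eq (κ y))

  module _ (x : Fin size) where

    𝒜 : Labeling P → ℕ
    𝒜 = antipodalSum P κ x

    𝒜-resp : 𝒜 Preserves _≗_ ⟶ _≡_
    𝒜-resp eq = cong₂ _+_ (eq x) (eq (κ x))

    𝒜+𝒜∘dual : ∀ {f} → InRange q f → 𝒜 f + 𝒜 (dual f) ≡ 2 * suc q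
    𝒜+𝒜∘dual {f} range = begin
      f x + f (κ x) + ((suc q ∸ f (κ x)) + (suc q ∸ f (κ (κ x))))   ≡⟨ cong (λ z → f x + f (κ x) + ((suc q ∸ f (κ x)) + (suc q ∸ f z))) (involutive x) ⟩
      f x + f (κ x) + ((suc q ∸ f (κ x)) + (suc q ∸ f x))           ≡⟨ regroup (f x) (f (κ x)) _ _ ⟩
      (f x + (suc q ∸ f x)) + (f (κ x) + (suc q ∸ f (κ x)))         ≡⟨ cong₂ _+_ (complement x) (complement (κ x)) ⟩
      suc q + suc q                                                 ≡⟨ cong (suc q +_) (+-identityʳ (suc q)) ⟨
      2 * suc q                                                     ∎
      where
      open ≡-Reasoning
      open +-*-Solver
      regroup : ∀ a b b′ a′ → a + b + (b′ + a′) ≡ (a + a′) + (b + b′)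
      regroup = solve 4 (λ a b b′ a′ → a :+ b :+ (b′ :+ a′) := (a :+ a′) :+ (b :+ b′)) refl
      complement : ∀ y → f y + (suc q ∸ f y) ≡ suc q
      complement y = m+[n∸m]≡n (m≤n⇒m≤1+n (proj₂ (range y)))

    ∑-𝒜-incList : ∑∈ (incList P q) 𝒜 ≡ suc q * length (incList P q)
    ∑-𝒜-incList = *-cancelˡ-≡ _ _ 2 (begin
      2 * ∑∈ L 𝒜                         ≡⟨ cong (∑∈ L 𝒜 +_) (+-identityʳ (∑∈ L 𝒜)) ⟩
      ∑∈ L 𝒜 + ∑∈ L 𝒜                    ≡⟨ cong (∑∈ L 𝒜 +_) dual-invariant ⟨
      ∑∈ L 𝒜 + ∑[ f ∈ L ] 𝒜 (dual f)     ≡⟨ ∑∈-+ L 𝒜 (λ f → 𝒜 (dual f)) ⟨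
      ∑[ f ∈ L ] (𝒜 f + 𝒜 (dual f))      ≡⟨ ∑∈-cong-local (All.map (λ inc → 𝒜+𝒜∘dual (proj₁ inc)) (proj₁ (incList-enumerates P q))) ⟩
      ∑[ _ ∈ L ] (2 * suc q)             ≡⟨ ∑∈-const L (2 * suc q) ⟩
      length L * (2 * suc q)             ≡⟨ trans (*-comm (length L) (2 * suc q)) (*-assoc 2 (suc q) (length L)) ⟩
      2 * (suc q * length L)             ∎)
      where
      open ≡-Reasoning
      L : List (Labeling P)
      L = incList P q
      dual-invariant : ∑[ f ∈ L ] 𝒜 (dual f) ≡ ∑∈ L 𝒜
      dual-invariant =
        ∑∈-involution (incList-enumerates P q) dual dual-isInc (λ inc → dual-involutive (proj₁ inc)) dual-resp 𝒜-resp

proposition6p4 :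
    (P : FinPoset) (D : SelfDual P) (x : Fin (FinPoset.size P))
    (q : ℕ) .{{_ : NonZero q}} (f : Labeling P) → IsInc P q f →
    (ℓ τ σ : ℕ) →
    IsConPeriod P q f ℓ →
    IsOrbitSize P (numUsed P q f) (deflate P f) τ →
    IsOrbitSize P q f σ →
    gcd (numUsed P q f * ℓ / q) τ ≡ 1 →
    IsXStable P (SelfDual.κ D) x (numUsed P q f) (deflate P f) τ →
    Orbitmesy P q f σ (antipodalSum P (SelfDual.κ D) x)
proposition6p4 P D x q f inc ℓ τ σ (ℓ≥1 , con-period , _) (τ≥1 , deflation-period , _) (_ , period , _) coprime stable = begin
  orbitSum P q f σ 𝒜 * length L     ≡⟨ cong (_* length L) (trans (sum-applyUpTo σ _) (OrbitSum.∑-𝒜-orbit σ period)) ⟩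
  σ * suc q * length L              ≡⟨ trans (*-assoc σ (suc q) (length L)) (*-comm σ (suc q * length L)) ⟩
  suc q * length L * σ              ≡⟨ cong (_* σ) (Duality.∑-𝒜-incList P D q x) ⟨
  sum (map 𝒜 L) * σ                 ∎
  where
  open ≡-Reasoning
  module OrbitSum = AntipodalOrbitSum P q f (proj₁ inc) (SelfDual.κ D) x ℓ τ ℓ≥1 τ≥1 con-period deflation-period coprime stable
  𝒜 = antipodalSum P (SelfDual.κ D) x
  L = incList P q
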